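{- Let $F=\mathbb{Q}(\sqrt d)$ be an imaginary quadratic field with $d<0$ a square-free integer. Orthogonal fractional ideals of $F$ can exist only when $d\equiv2,3\pmod 4$ (i.e. $\mathcal{O}_F=\mathbb{Z}[\sqrt d]$). In that case, a fractional ideal $I$ is orthogonal if and only if $[I]$ can be represented as a product of ideal classes of ramified prime ideals of the form $\mathbb{Z}r+\mathbb{Z}\sqrt d$, where $r$ is a prime dividing $d$.
   Context: $F$ is viewed as a quadratic space over $\mathbb{Q}$ with quadratic form $N_{F/\mathbb{Q}}$, orthogonal group $O(F)$, $O^-(F)=O(F)\setminus\mathrm{SL}(F)$. For a $\mathbb{Z}$-lattice $L$ on $F$, $O^-(L)=\{\rho\in O^-(F):\rho(L)=L\}$. $L$ is orthogonal with respect to $\rho\in O^-(L)$ if $L$ has a $\mathbb{Z}$-basis $\{x,y\}$ with $\rho(x)=x$, $\rho(y)=-y$; $L$ is orthogonal if it is orthogonal with respect to some $\rho\in O^-(L)$. A fractional ideal is orthogonal if it is orthogonal as a $\mathbb{Z}$-lattice on $F$. $[I]$ is the ideal class of $I$. -}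

module Defs where

open import Data.Nat as ℕ using (ℕ)
open import Data.Nat.Divisibility using (_∣_)
open import Data.Nat.Primality using (Prime)
open import Data.Integer as ℤ using (ℤ; +_; ∣_∣)
open import Data.Integer.DivMod using (_%ℕ_)
open import Data.Rational using (ℚ; 0ℚ; 1ℚ; ½; _+_; _*_; -_; _-_; _/_)
open import Data.List using (List; []; _∷_; concatMap; map; foldr)
open import Data.List.Relation.Unary.All using (All)
open import Data.Product using (Σ; ∃; _×_; _,_)
open import Data.Sum using (_⊎_)
open import Relation.Nullary using (¬_; does)
open import Relation.Binary.PropositionalEquality using (_≡_; _≢_)
open import Data.Bool using (if_then_else_)

SquareFree : ℤ → Set
SquareFree d = ∀ (n : ℕ) → (n ℕ.* n) ∣ ∣ d ∣ → n ≡ 1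

Cong23mod4 : ℤ → Set
Cong23mod4 d = (d %ℕ 4 ≡ 2) ⊎ (d %ℕ 4 ≡ 3)

-- Elements of F = ℚ(√d), written a + b√d with a b : ℚ (as a ℚ-vector space ℚ²)
record F : Set where
  constructor ⟨_,_⟩
  field
    re : ℚ
    im : ℚ
open F public

ℤ→ℚ : ℤ → ℚ
ℤ→ℚ n = n / 1

0F : F
0F = ⟨ 0ℚ , 0ℚ ⟩

1F : F
1F = ⟨ 1ℚ , 0ℚ ⟩

_+F_ : F → F → F
⟨ a , b ⟩ +F ⟨ c , e ⟩ = ⟨ a + c , b + e ⟩

negF : F → F
negF ⟨ a , b ⟩ = ⟨ - a , - b ⟩

_·F_ : ℤ → F → F
m ·F ⟨ a , b ⟩ = ⟨ ℤ→ℚ m * a , ℤ→ℚ m * b ⟩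

detF : F → F → ℚ
detF ⟨ a , b ⟩ ⟨ c , e ⟩ = a * e - b * c

module Field (d : ℤ) where

  dℚ : ℚ
  dℚ = ℤ→ℚ d

  _*F_ : F → F → F
  ⟨ a , b ⟩ *F ⟨ c , e ⟩ = ⟨ a * c + dℚ * (b * e) , a * e + b * c ⟩

  √d : F
  √d = ⟨ 0ℚ , 1ℚ ⟩

  N : F → ℚ
  N ⟨ a , b ⟩ = a * a - dℚ * (b * b)

  -- 𝒪_F = ℤ + ℤω
  ω : F
  ω = if does (d %ℕ 4 ℕ.≟ 1) then ⟨ ½ , ½ ⟩ else ⟨ 0ℚ , 1ℚ ⟩

  data InSpan : List F → F → Set where
    nil  : InSpan [] 0F
    cons : ∀ {g gs x} (m : ℤ) → InSpan gs x → InSpan (g ∷ gs) ((m ·F g) +F x)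

  FullRank : List F → Set
  FullRank gs = Σ F λ x → Σ F λ y → InSpan gs x × InSpan gs y × detF x y ≢ 0ℚ

  -- fractional ideal of F: a ℤ-lattice on F which is an 𝒪_F-module
  record FracIdeal : Set where
    field
      gens     : List F
      fullRank : FullRank gens
      ωclosed  : ∀ x → InSpan gens x → InSpan gens (ω *F x)
  open FracIdeal public

  record Lin : Set where
    constructor mat
    field
      m11 m12 m21 m22 : ℚ

  app : Lin → F → F
  app (mat p q r s) ⟨ a , b ⟩ = ⟨ p * a + q * b , r * a + s * b ⟩

  det : Lin → ℚ
  det (mat p q r s) = p * s - q * r

  InOminusF : Lin → Set
  InOminusF ρ = (∀ x → N (app ρ x) ≡ N x) × det ρ ≡ - 1ℚ

  InOminus : List F → Lin → Set
  InOminus L ρ = InOminusF ρ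
               × (∀ x → InSpan L x → InSpan L (app ρ x))
               × (∀ y → InSpan L y → Σ F λ x → InSpan L x × app ρ x ≡ y)

  ZBasis : List F → F → F → Set
  ZBasis L x y = InSpan L x × InSpan L y × detF x y ≢ 0ℚ
               × (∀ z → InSpan L z → Σ ℤ λ m → Σ ℤ λ n → z ≡ (m ·F x) +F (n ·F y))

  OrthogonalWrt : List F → Lin → Set
  OrthogonalWrt L ρ = Σ F λ x → Σ F λ y →
    ZBasis L x y × app ρ x ≡ x × app ρ y ≡ negF y

  Orthogonal : List F → Set
  Orthogonal L = Σ Lin λ ρ → InOminus L ρ × OrthogonalWrt L ρ

  SameClass : List F → List F → Set
  SameClass I J = Σ F λ α → α ≢ 0F ×
    (∀ x → InSpan J x → Σ F λ y → InSpan I y × x ≡ α *F y) ×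
    (∀ y → InSpan I y → InSpan J (α *F y))

  prodGens : List F → List F → List F
  prodGens I J = concatMap (λ g → map (λ h → g *F h) J) I

  OFgens : List F
  OFgens = 1F ∷ ω ∷ []

  prodAll : List (List F) → List F
  prodAll = foldr prodGens OFgens

  Pr : ℕ → List F
  Pr r = ⟨ ℤ→ℚ (+ r) , 0ℚ ⟩ ∷ √d ∷ []

  ProdOfRamifiedClasses : List F → Set
  ProdOfRamifiedClasses I = Σ (List ℕ) λ rs →
    All (λ r → Prime r × r ∣ ∣ d ∣) rs × SameClass I (prodAll (map Pr rs))

{-# OPTIONS --safe #-}
-- Let B be the polar form of the norm, so B z z = N z. A lattice is orthogonal exactly when it has a
-- ℤ-basis x, y with B x y = 0: an isometry fixing x and negating y gives N (x + y) = N (x - y), that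
-- is 4 B x y = 0, and conversely z ↦ (x / x̄) z̄ is such an isometry (N x ≠ 0 because d < 0).
--
-- Square-freeness rules out d ≡ 0 mod 4. If d ≡ 1 mod 4 the ideal contains ω y = m x + k y with
-- ω = (1 + √d) / 2, and pairing with y gives ½ N y = k N y, which is impossible. If d ≡ 2, 3 mod 4
-- then ω = √d, and B (√d z) z = 0 forces √d y = a x and √d x = b y, so d = a b; multiplying by a / y
-- carries the ideal onto ∣a∣ ℤ + ℤ √d. Conversely, a product of ideals ℤ r + ℤ √d (r prime, r ∣ d)
-- is k (m ℤ + ℤ √d) with k² m the product of the r's and m ∣ d, by induction on the factors using
-- Bézout for r and m, or for r and d / m when r ∣ m; its basis k m, k √d is orthogonal. When the
-- r's are the prime factors of the squarefree ∣a∣ this gives k = 1 and m = ∣a∣.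

module Submission where

open import Defs
open import Data.Bool using (if_then_else_)
open import Data.Empty using (⊥-elim)
open import Data.Integer as ℤ using (ℤ; +_; -[1+_]; ∣_∣; _<_)
import Data.Integer.Properties as ℤ
open import Data.Integer.DivMod using (_%ℕ_; _/ℕ_; n%ℕd<d; a≡a%ℕn+[a/ℕn]*n)
open import Data.Integer.Tactic.RingSolver using (solve-∀)
open import Data.List using (List; []; _∷_; _++_; map)
open import Data.List.Relation.Unary.All as All using (All; []; _∷_)
open import Data.Nat as ℕ using (ℕ; suc; s≤s)
import Data.Nat.Properties as ℕ
import Data.Nat.Tactic.RingSolver as ℕ-Solver
open import Data.Nat.Coprimality using (Coprime; coprime-Bézout; coprime-divisor)
open import Data.Nat.Divisibility using (_∣_; divides; quotient; 1∣_; _∣?_; ∣-trans)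
open import Data.Nat.GCD using (module Bézout)
open import Data.Nat.ListAction using (product)
open import Data.Nat.ListAction.Properties using (∈⇒∣product)
open import Data.Nat.Primality using (Prime; prime⇒irreducible; prime⇒nonTrivial; productOfPrimes≢0)
open import Data.Nat.Primality.Factorisation using (PrimeFactorisation; factorise)
open import Data.Product using (∃; ∃₂; _×_; _,_; proj₁; proj₂)
open import Data.Rational as ℚ using (ℚ; 0ℚ; 1ℚ; ½; _+_; _*_; -_; _-_; 1/_; toℚᵘ)
import Data.Rational.Properties as ℚ
open import Data.Rational.Unnormalised as ℚᵘ using (mkℚᵘ; *≡*)
import Data.Rational.Unnormalised.Properties as ℚᵘ
open import Data.Sum using (_⊎_; inj₁; inj₂)
open import Function using (case_of_)
open import Function.Bundles using (_⇔_; mk⇔)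
open import Level using (0ℓ)
open import Relation.Binary.PropositionalEquality
open import Relation.Nullary using (¬_; yes; no)
open import Relation.Nullary.Decidable using (dec⇒maybe; dec-true; dec-false)
import Tactic.RingSolver as RingSolver
open import Tactic.RingSolver.Core.AlmostCommutativeRing using (AlmostCommutativeRing; fromCommutativeRing)

ringℚ : AlmostCommutativeRing 0ℓ 0ℓ
ringℚ = fromCommutativeRing ℚ.+-*-commutativeRing (λ p → dec⇒maybe (0ℚ ℚ.≟ p))

p*q≡0⇒p≡0∨q≡0 : ∀ p q → p * q ≡ 0ℚ → p ≡ 0ℚ ⊎ q ≡ 0ℚ
p*q≡0⇒p≡0∨q≡0 p q pq≡0 with p ℚ.≟ 0ℚ
... | yes p≡0 = inj₁ p≡0
... | no p≢0 = inj₂ (begin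
    q               ≡⟨ ℚ.*-identityˡ q ⟨
    1ℚ * q          ≡⟨ cong (_* q) (ℚ.*-inverseˡ p) ⟨
    1/ p * p * q    ≡⟨ ℚ.*-assoc (1/ p) p q ⟩
    1/ p * (p * q)  ≡⟨ cong (1/ p *_) pq≡0 ⟩
    1/ p * 0ℚ       ≡⟨ ℚ.*-zeroʳ (1/ p) ⟩
    0ℚ              ∎)
  where open ≡-Reasoning
        instance _ = ℚ.≢-nonZero p≢0

p≢0∧p*q≡0⇒q≡0 : ∀ {p q} → p ≢ 0ℚ → p * q ≡ 0ℚ → q ≡ 0ℚ
p≢0∧p*q≡0⇒q≡0 {p} {q} p≢0 pq≡0 with p*q≡0⇒p≡0∨q≡0 p q pq≡0
... | inj₁ p≡0 = ⊥-elim (p≢0 p≡0)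
... | inj₂ q≡0 = q≡0

q≢0∧p*q≡0⇒p≡0 : ∀ {p q} → q ≢ 0ℚ → p * q ≡ 0ℚ → p ≡ 0ℚ
q≢0∧p*q≡0⇒p≡0 {p} {q} q≢0 pq≡0 = p≢0∧p*q≡0⇒q≡0 q≢0 (trans (ℚ.*-comm q p) pq≡0)

p*p≡0⇒p≡0 : ∀ p → p * p ≡ 0ℚ → p ≡ 0ℚ
p*p≡0⇒p≡0 p pp≡0 with p*q≡0⇒p≡0∨q≡0 p p pp≡0
... | inj₁ p≡0 = p≡0
... | inj₂ p≡0 = p≡0

*-cancelʳ-≡ : ∀ {p q r} → r ≢ 0ℚ → p * r ≡ q * r → p ≡ q
*-cancelʳ-≡ {p} {q} {r} r≢0 pr≡qr = begin
  p              ≡⟨ sub-add p q ⟩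
  (p - q) + q    ≡⟨ cong (_+ q) (q≢0∧p*q≡0⇒p≡0 {p - q} r≢0 [p-q]r≡0) ⟩
  0ℚ + q         ≡⟨ ℚ.+-identityˡ q ⟩
  q              ∎
  where
  open ≡-Reasoning
  sub-add : ∀ p q → p ≡ (p - q) + q
  sub-add = RingSolver.solve-∀ ringℚ
  [p-q]r≡0 : (p - q) * r ≡ 0ℚ
  [p-q]r≡0 = trans (ℚ.*-distribʳ-+ r p (- q))
               (trans (cong (λ t → p * r + t) (sym (ℚ.neg-distribˡ-* q r)))
               (trans (cong (λ t → t - q * r) pr≡qr) (ℚ.+-inverseʳ (q * r))))

ℚ-inverseʳ : ∀ {p} → p ≢ 0ℚ → ∃ λ q → p * q ≡ 1ℚ
ℚ-inverseʳ {p} p≢0 = 1/ p , ℚ.*-inverseʳ p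
  where instance _ = ℚ.≢-nonZero p≢0

p*p≥0 : ∀ p → 0ℚ ℚ.≤ p * p
p*p≥0 p@(ℚ.mkℚ (+ _) _ _)    = ℚ.nonNegative⁻¹ (p * p) {{ℚ.nonNeg*nonNeg⇒nonNeg p p}}
p*p≥0 p@(ℚ.mkℚ -[1+ _ ] _ _) = ℚ.nonNegative⁻¹ (p * p) {{ℚ.pos⇒nonNeg (p * p) {{ℚ.neg*neg⇒pos p p}}}}

p≥0∧q≥0∧p+q≡0⇒p≡0 : ∀ {p q} → 0ℚ ℚ.≤ p → 0ℚ ℚ.≤ q → p + q ≡ 0ℚ → p ≡ 0ℚ
p≥0∧q≥0∧p+q≡0⇒p≡0 {p} {q} 0≤p 0≤q p+q≡0 = ℚ.≤-antisym p≤0 0≤p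
  where
  open ℚ.≤-Reasoning
  p≤0 : p ℚ.≤ 0ℚ
  p≤0 = begin
    p       ≡⟨ ℚ.+-identityʳ p ⟨
    p + 0ℚ  ≤⟨ ℚ.+-monoʳ-≤ p 0≤q ⟩
    p + q   ≡⟨ p+q≡0 ⟩
    0ℚ      ∎

toℚᵘ-ℤ→ℚ : ∀ a → toℚᵘ (ℤ→ℚ a) ℚᵘ.≃ mkℚᵘ a 0
toℚᵘ-ℤ→ℚ a = ℚ.toℚᵘ-fromℚᵘ (mkℚᵘ a 0)

ℤ→ℚ-+ : ∀ a b → ℤ→ℚ (a ℤ.+ b) ≡ ℤ→ℚ a + ℤ→ℚ b
ℤ→ℚ-+ a b = ℚ.toℚᵘ-injective (begin
  toℚᵘ (ℤ→ℚ (a ℤ.+ b))              ≈⟨ toℚᵘ-ℤ→ℚ (a ℤ.+ b) ⟩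
  mkℚᵘ (a ℤ.+ b) 0                  ≈⟨ *≡* (denominators-one a b) ⟩
  mkℚᵘ a 0 ℚᵘ.+ mkℚᵘ b 0            ≈⟨ ℚᵘ.+-cong (toℚᵘ-ℤ→ℚ a) (toℚᵘ-ℤ→ℚ b) ⟨
  toℚᵘ (ℤ→ℚ a) ℚᵘ.+ toℚᵘ (ℤ→ℚ b)    ≈⟨ ℚ.toℚᵘ-homo-+ (ℤ→ℚ a) (ℤ→ℚ b) ⟨
  toℚᵘ (ℤ→ℚ a + ℤ→ℚ b)              ∎)
  where
  open ℚᵘ.≃-Reasoning
  denominators-one : ∀ a b → (a ℤ.+ b) ℤ.* + 1 ≡ (a ℤ.* + 1 ℤ.+ b ℤ.* + 1) ℤ.* + 1
  denominators-one = solve-∀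

ℤ→ℚ-* : ∀ a b → ℤ→ℚ (a ℤ.* b) ≡ ℤ→ℚ a * ℤ→ℚ b
ℤ→ℚ-* a b = ℚ.toℚᵘ-injective (begin
  toℚᵘ (ℤ→ℚ (a ℤ.* b))              ≈⟨ toℚᵘ-ℤ→ℚ (a ℤ.* b) ⟩
  mkℚᵘ (a ℤ.* b) 0                  ≈⟨ *≡* refl ⟩
  mkℚᵘ a 0 ℚᵘ.* mkℚᵘ b 0            ≈⟨ ℚᵘ.*-cong (toℚᵘ-ℤ→ℚ a) (toℚᵘ-ℤ→ℚ b) ⟨
  toℚᵘ (ℤ→ℚ a) ℚᵘ.* toℚᵘ (ℤ→ℚ b)    ≈⟨ ℚ.toℚᵘ-homo-* (ℤ→ℚ a) (ℤ→ℚ b) ⟨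
  toℚᵘ (ℤ→ℚ a * ℤ→ℚ b)              ∎)
  where open ℚᵘ.≃-Reasoning

ℤ→ℚ-neg : ∀ a → ℤ→ℚ (ℤ.- a) ≡ - ℤ→ℚ a
ℤ→ℚ-neg a = ℚ.toℚᵘ-injective (begin
  toℚᵘ (ℤ→ℚ (ℤ.- a))    ≈⟨ toℚᵘ-ℤ→ℚ (ℤ.- a) ⟩
  mkℚᵘ (ℤ.- a) 0        ≈⟨ *≡* refl ⟩
  ℚᵘ.- mkℚᵘ a 0         ≈⟨ ℚᵘ.-‿cong (toℚᵘ-ℤ→ℚ a) ⟨
  ℚᵘ.- toℚᵘ (ℤ→ℚ a)     ≈⟨ ℚ.toℚᵘ-homo‿- (ℤ→ℚ a) ⟨
  toℚᵘ (- ℤ→ℚ a)        ∎)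
  where open ℚᵘ.≃-Reasoning

ℤ→ℚ-injective : ∀ {a b} → ℤ→ℚ a ≡ ℤ→ℚ b → a ≡ b
ℤ→ℚ-injective {a} {b} eq with ℚᵘ.≃-trans (ℚᵘ.≃-sym (toℚᵘ-ℤ→ℚ a)) (ℚᵘ.≃-trans (ℚ.toℚᵘ-cong eq) (toℚᵘ-ℤ→ℚ b))
... | *≡* a*1≡b*1 = trans (sym (ℤ.*-identityʳ a)) (trans a*1≡b*1 (ℤ.*-identityʳ b))

½≢ℤ→ℚ : ∀ m → ½ ≢ ℤ→ℚ m
½≢ℤ→ℚ m ½≡m = m+m≢1 m (ℤ→ℚ-injective (trans (ℤ→ℚ-+ m m) (sym (cong₂ _+_ ½≡m ½≡m))))
  where
  m+m≢1 : ∀ m → m ℤ.+ m ≢ + 1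
  m+m≢1 (+ 0)           ()
  m+m≢1 (+ 1)           ()
  m+m≢1 (+ suc (suc _)) ()
  m+m≢1 -[1+ _ ]        ()

∣i∣ℤ⊆iℤ : ∀ i j → ∃ λ k → k ℤ.* i ≡ + ∣ i ∣ ℤ.* j
∣i∣ℤ⊆iℤ (+ n)    j = j , ℤ.*-comm j (+ n)
∣i∣ℤ⊆iℤ -[1+ n ] j = ℤ.- j , negate-both j (+ suc n)
  where
  negate-both : ∀ j m → ℤ.- j ℤ.* ℤ.- m ≡ m ℤ.* j
  negate-both = solve-∀

iℤ⊆∣i∣ℤ : ∀ i j → ∃ λ k → + ∣ i ∣ ℤ.* k ≡ j ℤ.* i
iℤ⊆∣i∣ℤ (+ n)    j = j , ℤ.*-comm (+ n) j
iℤ⊆∣i∣ℤ -[1+ n ] j = ℤ.- j , negate-both j (+ suc n)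
  where
  negate-both : ∀ j m → m ℤ.* ℤ.- j ≡ j ℤ.* ℤ.- m
  negate-both = solve-∀

-[D]≡-[e*a*b] : ∀ {D e a b} → D ≡ e ℕ.* (a ℕ.* b) → ℤ.- (+ D) ≡ ℤ.- (+ e ℤ.* (+ a ℤ.* + b))
-[D]≡-[e*a*b] {D} {e} {a} {b} D≡eab = cong ℤ.-_ (begin
  + D                      ≡⟨ cong +_ D≡eab ⟩
  + (e ℕ.* (a ℕ.* b))      ≡⟨ ℤ.pos-* e (a ℕ.* b) ⟩
  + e ℤ.* + (a ℕ.* b)      ≡⟨ cong (ℤ._*_ (+ e)) (ℤ.pos-* a b) ⟩
  + e ℤ.* (+ a ℤ.* + b)    ∎)
  where open ≡-Reasoning

prime⇒≢1 : ∀ {p} → Prime p → p ≢ 1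
prime⇒≢1 p-prime = ℕ.nonTrivial⇒≢1 {{prime⇒nonTrivial p-prime}}

prime∤⇒coprime : ∀ {p n} → Prime p → ¬ p ∣ n → Coprime p n
prime∤⇒coprime p-prime p∤n (i∣p , i∣n) with prime⇒irreducible p-prime i∣p
... | inj₁ i≡1 = i≡1
... | inj₂ refl = ⊥-elim (p∤n i∣n)

1+yb≡xa⇒xa-yb≡1 : ∀ x a y b → 1 ℕ.+ y ℕ.* b ≡ x ℕ.* a → + x ℤ.* + a ℤ.+ ℤ.- + y ℤ.* + b ≡ + 1
1+yb≡xa⇒xa-yb≡1 x a y b eq = begin
  + x ℤ.* + a ℤ.+ ℤ.- + y ℤ.* + b              ≡⟨ cong (ℤ._+ ℤ.- + y ℤ.* + b) xa≡1+yb ⟩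
  + 1 ℤ.+ + y ℤ.* + b ℤ.+ ℤ.- + y ℤ.* + b      ≡⟨ cancel (+ y) (+ b) ⟩
  + 1                                          ∎
  where
  open ≡-Reasoning
  xa≡1+yb : + x ℤ.* + a ≡ + 1 ℤ.+ + y ℤ.* + b
  xa≡1+yb = trans (sym (ℤ.pos-* x a)) (trans (cong +_ (sym eq))
              (trans (ℤ.pos-+ 1 (y ℕ.* b)) (cong (ℤ._+_ (+ 1)) (ℤ.pos-* y b))))
  cancel : ∀ y b → + 1 ℤ.+ y ℤ.* b ℤ.+ ℤ.- y ℤ.* b ≡ + 1
  cancel = solve-∀

coprime⇒ℤ-bézout : ∀ {a b} → Coprime a b → ∃₂ λ s t → s ℤ.* + a ℤ.+ t ℤ.* + b ≡ + 1
coprime⇒ℤ-bézout {a} {b} a⊥b with coprime-Bézout a⊥b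
... | Bézout.+- x y eq = + x , ℤ.- + y , 1+yb≡xa⇒xa-yb≡1 x a y b eq
... | Bézout.-+ x y eq = ℤ.- + x , + y ,
  trans (ℤ.+-comm (ℤ.- + x ℤ.* + a) (+ y ℤ.* + b)) (1+yb≡xa⇒xa-yb≡1 y b x a eq)

module Arithmetic (d : ℤ) where
  open Field d

  +F-assoc : ∀ x y z → (x +F y) +F z ≡ x +F (y +F z)
  +F-assoc ⟨ a , b ⟩ ⟨ c , e ⟩ ⟨ f , g ⟩ = cong₂ ⟨_,_⟩ (ℚ.+-assoc a c f) (ℚ.+-assoc b e g)

  +F-comm : ∀ x y → x +F y ≡ y +F x
  +F-comm ⟨ a , b ⟩ ⟨ c , e ⟩ = cong₂ ⟨_,_⟩ (ℚ.+-comm a c) (ℚ.+-comm b e)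

  +F-identityˡ : ∀ x → 0F +F x ≡ x
  +F-identityˡ ⟨ a , b ⟩ = cong₂ ⟨_,_⟩ (ℚ.+-identityˡ a) (ℚ.+-identityˡ b)

  +F-identityʳ : ∀ x → x +F 0F ≡ x
  +F-identityʳ ⟨ a , b ⟩ = cong₂ ⟨_,_⟩ (ℚ.+-identityʳ a) (ℚ.+-identityʳ b)

  ·F-distribˡ : ∀ m x y → m ·F (x +F y) ≡ (m ·F x) +F (m ·F y)
  ·F-distribˡ m ⟨ a , b ⟩ ⟨ c , e ⟩ =
    cong₂ ⟨_,_⟩ (ℚ.*-distribˡ-+ (ℤ→ℚ m) a c) (ℚ.*-distribˡ-+ (ℤ→ℚ m) b e)

  ·F-distribʳ : ∀ m n x → (m ℤ.+ n) ·F x ≡ (m ·F x) +F (n ·F x)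
  ·F-distribʳ m n ⟨ a , b ⟩ rewrite ℤ→ℚ-+ m n =
    cong₂ ⟨_,_⟩ (ℚ.*-distribʳ-+ a (ℤ→ℚ m) (ℤ→ℚ n)) (ℚ.*-distribʳ-+ b (ℤ→ℚ m) (ℤ→ℚ n))

  ·F-assoc : ∀ m n x → (m ℤ.* n) ·F x ≡ m ·F (n ·F x)
  ·F-assoc m n ⟨ a , b ⟩ rewrite ℤ→ℚ-* m n =
    cong₂ ⟨_,_⟩ (ℚ.*-assoc (ℤ→ℚ m) (ℤ→ℚ n) a) (ℚ.*-assoc (ℤ→ℚ m) (ℤ→ℚ n) b)

  ·F-zeroˡ : ∀ x → (+ 0) ·F x ≡ 0F
  ·F-zeroˡ ⟨ a , b ⟩ = cong₂ ⟨_,_⟩ (ℚ.*-zeroˡ a) (ℚ.*-zeroˡ b)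

  ·F-zeroʳ : ∀ m → m ·F 0F ≡ 0F
  ·F-zeroʳ m = cong₂ ⟨_,_⟩ (ℚ.*-zeroʳ (ℤ→ℚ m)) (ℚ.*-zeroʳ (ℤ→ℚ m))

  *F-comm : ∀ x y → x *F y ≡ y *F x
  *F-comm ⟨ a , b ⟩ ⟨ c , e ⟩ = cong₂ ⟨_,_⟩ (re-comm dℚ a b c e) (im-comm a b c e)
    where
    re-comm : ∀ d a b c e → a * c + d * (b * e) ≡ c * a + d * (e * b)
    re-comm = RingSolver.solve-∀ ringℚ
    im-comm : ∀ a b c e → a * e + b * c ≡ c * b + e * a
    im-comm = RingSolver.solve-∀ ringℚ

  *F-assoc : ∀ x y z → (x *F y) *F z ≡ x *F (y *F z)
  *F-assoc ⟨ a , b ⟩ ⟨ c , e ⟩ ⟨ f , g ⟩ = cong₂ ⟨_,_⟩ (re-assoc dℚ a b c e f g) (im-assoc dℚ a b c e f g)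
    where
    re-assoc : ∀ d a b c e f g → (a * c + d * (b * e)) * f + d * ((a * e + b * c) * g)
                                 ≡ a * (c * f + d * (e * g)) + d * (b * (c * g + e * f))
    re-assoc = RingSolver.solve-∀ ringℚ
    im-assoc : ∀ d a b c e f g → (a * c + d * (b * e)) * g + (a * e + b * c) * f
                                 ≡ a * (c * g + e * f) + b * (c * f + d * (e * g))
    im-assoc = RingSolver.solve-∀ ringℚ

  *F-distribˡ : ∀ x y z → x *F (y +F z) ≡ (x *F y) +F (x *F z)
  *F-distribˡ ⟨ a , b ⟩ ⟨ c , e ⟩ ⟨ f , g ⟩ = cong₂ ⟨_,_⟩ (re-distrib dℚ a b c e f g) (im-distrib a b c e f g)
    where
    re-distrib : ∀ d a b c e f g → a * (c + f) + d * (b * (e + g)) ≡ (a * c + d * (b * e)) + (a * f + d * (b * g))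
    re-distrib = RingSolver.solve-∀ ringℚ
    im-distrib : ∀ a b c e f g → a * (e + g) + b * (c + f) ≡ (a * e + b * c) + (a * g + b * f)
    im-distrib = RingSolver.solve-∀ ringℚ

  *F-·F : ∀ m x y → x *F (m ·F y) ≡ m ·F (x *F y)
  *F-·F m ⟨ a , b ⟩ ⟨ c , e ⟩ = cong₂ ⟨_,_⟩ (re-scale dℚ (ℤ→ℚ m) a b c e) (im-scale (ℤ→ℚ m) a b c e)
    where
    re-scale : ∀ d m a b c e → a * (m * c) + d * (b * (m * e)) ≡ m * (a * c + d * (b * e))
    re-scale = RingSolver.solve-∀ ringℚ
    im-scale : ∀ m a b c e → a * (m * e) + b * (m * c) ≡ m * (a * e + b * c)
    im-scale = RingSolver.solve-∀ ringℚ

  *F-zeroʳ : ∀ x → x *F 0F ≡ 0F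
  *F-zeroʳ ⟨ a , b ⟩ = cong₂ ⟨_,_⟩ (re-zero dℚ a b) (im-zero a b)
    where
    re-zero : ∀ d a b → a * 0ℚ + d * (b * 0ℚ) ≡ 0ℚ
    re-zero = RingSolver.solve-∀ ringℚ
    im-zero : ∀ a b → a * 0ℚ + b * 0ℚ ≡ 0ℚ
    im-zero = RingSolver.solve-∀ ringℚ

  *F-identityˡ : ∀ x → 1F *F x ≡ x
  *F-identityˡ ⟨ a , b ⟩ = cong₂ ⟨_,_⟩ (re-one dℚ a b) (im-one a b)
    where
    re-one : ∀ d a b → 1ℚ * a + d * (0ℚ * b) ≡ a
    re-one = RingSolver.solve-∀ ringℚ
    im-one : ∀ a b → 1ℚ * b + 0ℚ * a ≡ b
    im-one = RingSolver.solve-∀ ringℚ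

  *F-identityʳ : ∀ x → x *F 1F ≡ x
  *F-identityʳ x = trans (*F-comm x 1F) (*F-identityˡ x)

  *F-lincomb : ∀ α m n x y → α *F ((m ·F x) +F (n ·F y)) ≡ (m ·F (α *F x)) +F (n ·F (α *F y))
  *F-lincomb α m n x y = trans (*F-distribˡ α (m ·F x) (n ·F y)) (cong₂ _+F_ (*F-·F m α x) (*F-·F n α y))

  app-+F : ∀ ρ x y → app ρ (x +F y) ≡ app ρ x +F app ρ y
  app-+F (mat p q r s) ⟨ a , b ⟩ ⟨ c , e ⟩ = cong₂ ⟨_,_⟩ (additive p q a b c e) (additive r s a b c e)
    where
    additive : ∀ p q a b c e → p * (a + c) + q * (b + e) ≡ (p * a + q * b) + (p * c + q * e)
    additive = RingSolver.solve-∀ ringℚ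

  app-lincomb : ∀ ρ m n x y → app ρ ((m ·F x) +F (n ·F y)) ≡ (m ·F app ρ x) +F (n ·F app ρ y)
  app-lincomb (mat p q r s) m n ⟨ a , b ⟩ ⟨ c , e ⟩ =
    cong₂ ⟨_,_⟩ (linear p q (ℤ→ℚ m) (ℤ→ℚ n) a b c e) (linear r s (ℤ→ℚ m) (ℤ→ℚ n) a b c e)
    where
    linear : ∀ p q m n a b c e → p * (m * a + n * c) + q * (m * b + n * e)
                                 ≡ m * (p * a + q * b) + n * (p * c + q * e)
    linear = RingSolver.solve-∀ ringℚ

  ·F-negF : ∀ m x → m ·F negF x ≡ (ℤ.- m) ·F x
  ·F-negF m ⟨ a , b ⟩ rewrite ℤ→ℚ-neg m = cong₂ ⟨_,_⟩ (neg-swap (ℤ→ℚ m) a) (neg-swap (ℤ→ℚ m) b)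
    where
    neg-swap : ∀ m a → m * (- a) ≡ (- m) * a
    neg-swap = RingSolver.solve-∀ ringℚ

  InSpan-0 : ∀ L → InSpan L 0F
  InSpan-0 [] = nil
  InSpan-0 (g ∷ L) = subst (InSpan (g ∷ L)) (trans (cong (_+F 0F) (·F-zeroˡ g)) (+F-identityˡ 0F))
                       (cons (+ 0) (InSpan-0 L))

  InSpan-+ : ∀ {L x y} → InSpan L x → InSpan L y → InSpan L (x +F y)
  InSpan-+ nil t = subst (InSpan _) (sym (+F-identityˡ _)) t
  InSpan-+ {g ∷ L} (cons {x = x} m s) (cons {x = x′} n t) =
    subst (InSpan (g ∷ L)) interchange (cons (m ℤ.+ n) (InSpan-+ s t))
    where
    open ≡-Reasoning
    interchange : ((m ℤ.+ n) ·F g) +F (x +F x′) ≡ ((m ·F g) +F x) +F ((n ·F g) +F x′)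
    interchange = begin
      ((m ℤ.+ n) ·F g) +F (x +F x′)        ≡⟨ cong (_+F (x +F x′)) (·F-distribʳ m n g) ⟩
      ((m ·F g) +F (n ·F g)) +F (x +F x′)  ≡⟨ +F-assoc (m ·F g) (n ·F g) (x +F x′) ⟩
      (m ·F g) +F ((n ·F g) +F (x +F x′))  ≡⟨ cong ((m ·F g) +F_) (+F-assoc (n ·F g) x x′) ⟨
      (m ·F g) +F (((n ·F g) +F x) +F x′)  ≡⟨ cong (λ t → (m ·F g) +F (t +F x′)) (+F-comm (n ·F g) x) ⟩
      (m ·F g) +F ((x +F (n ·F g)) +F x′)  ≡⟨ cong ((m ·F g) +F_) (+F-assoc x (n ·F g) x′) ⟩
      (m ·F g) +F (x +F ((n ·F g) +F x′))  ≡⟨ +F-assoc (m ·F g) x ((n ·F g) +F x′) ⟨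
      ((m ·F g) +F x) +F ((n ·F g) +F x′)  ∎

  InSpan-· : ∀ {L x} k → InSpan L x → InSpan L (k ·F x)
  InSpan-· k nil = subst (InSpan []) (sym (·F-zeroʳ k)) nil
  InSpan-· k (cons {g = g} {x = x} m s) =
    subst (InSpan _) (trans (cong (_+F (k ·F x)) (·F-assoc k m g)) (sym (·F-distribˡ k _ _)))
      (cons (k ℤ.* m) (InSpan-· k s))

  InSpan-lincomb : ∀ {L x y} m n → InSpan L x → InSpan L y → InSpan L ((m ·F x) +F (n ·F y))
  InSpan-lincomb m n s t = InSpan-+ (InSpan-· m s) (InSpan-· n t)

  InSpan-++⁻ : ∀ A {B z} → InSpan (A ++ B) z → ∃₂ λ z₁ z₂ → InSpan A z₁ × InSpan B z₂ × z ≡ z₁ +F z₂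
  InSpan-++⁻ [] {z = z} z∈B = 0F , z , nil , z∈B , sym (+F-identityˡ z)
  InSpan-++⁻ (g ∷ A) (cons m z∈A++B) with InSpan-++⁻ A z∈A++B
  ... | z₁ , z₂ , z₁∈A , z₂∈B , refl = (m ·F g) +F z₁ , z₂ , cons m z₁∈A , z₂∈B , sym (+F-assoc (m ·F g) z₁ z₂)

  InSpan-++⁺ : ∀ A {B z₁ z₂} → InSpan A z₁ → InSpan B z₂ → InSpan (A ++ B) (z₁ +F z₂)
  InSpan-++⁺ A {B} z₁∈A z₂∈B = InSpan-+ (inj-left A z₁∈A) (inj-right A z₂∈B)
    where
    inj-left : ∀ A {z} → InSpan A z → InSpan (A ++ B) z
    inj-left [] nil = InSpan-0 B
    inj-left (g ∷ A) (cons m z∈A) = cons m (inj-left A z∈A)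
    inj-right : ∀ A {z} → InSpan B z → InSpan (A ++ B) z
    inj-right [] z∈B = z∈B
    inj-right (g ∷ A) {z} z∈B =
      subst (InSpan (g ∷ A ++ B)) (trans (cong (_+F z) (·F-zeroˡ g)) (+F-identityˡ z)) (cons (+ 0) (inj-right A z∈B))

  InSpan-map-*F⁻ : ∀ g G {z} → InSpan (map (g *F_) G) z → ∃ λ w → InSpan G w × z ≡ g *F w
  InSpan-map-*F⁻ g [] nil = 0F , nil , sym (*F-zeroʳ g)
  InSpan-map-*F⁻ g (h ∷ G) (cons m z∈gG) with InSpan-map-*F⁻ g G z∈gG
  ... | w , w∈G , refl = (m ·F h) +F w , cons m w∈G ,
    trans (cong (_+F (g *F w)) (sym (*F-·F m g h))) (sym (*F-distribˡ g (m ·F h) w))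

  InSpan-map-*F⁺ : ∀ g G {w} → InSpan G w → InSpan (map (g *F_) G) (g *F w)
  InSpan-map-*F⁺ g [] nil = subst (InSpan []) (sym (*F-zeroʳ g)) nil
  InSpan-map-*F⁺ g (h ∷ G) (cons {x = w} m w∈G) =
    subst (InSpan (map (g *F_) (h ∷ G)))
      (trans (cong (_+F (g *F w)) (sym (*F-·F m g h))) (sym (*F-distribˡ g (m ·F h) w)))
      (cons m (InSpan-map-*F⁺ g G w∈G))

  InSpan-prodGens₂⁻ : ∀ g h G {z} → InSpan (prodGens (g ∷ h ∷ []) G) z →
                      ∃₂ λ w₁ w₂ → InSpan G w₁ × InSpan G w₂ × z ≡ (g *F w₁) +F (h *F w₂)
  InSpan-prodGens₂⁻ g h G z∈GH with InSpan-++⁻ (map (g *F_) G) z∈GH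
  ... | z₁ , z₂ , z₁∈gG , z₂∈hG , refl with InSpan-map-*F⁻ g G z₁∈gG | InSpan-++⁻ (map (h *F_) G) z₂∈hG
  ... | w₁ , w₁∈G , refl | z₃ , z₄ , z₃∈hG , nil , refl with InSpan-map-*F⁻ h G z₃∈hG
  ... | w₂ , w₂∈G , refl = w₁ , w₂ , w₁∈G , w₂∈G , cong ((g *F w₁) +F_) (+F-identityʳ (h *F w₂))

  InSpan-prodGens₂⁺ : ∀ g h G {w₁ w₂} → InSpan G w₁ → InSpan G w₂ →
                      InSpan (prodGens (g ∷ h ∷ []) G) ((g *F w₁) +F (h *F w₂))
  InSpan-prodGens₂⁺ g h G {w₁} {w₂} w₁∈G w₂∈G =
    subst (λ t → InSpan (prodGens (g ∷ h ∷ []) G) ((g *F w₁) +F t)) (+F-identityʳ (h *F w₂))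
      (InSpan-++⁺ (map (g *F_) G) (InSpan-map-*F⁺ g G w₁∈G) (InSpan-++⁺ (map (h *F_) G) (InSpan-map-*F⁺ h G w₂∈G) nil))

module PolarForm (d : ℤ) where
  open Field d
  open Arithmetic d

  B : F → F → ℚ
  B ⟨ a , b ⟩ ⟨ c , e ⟩ = a * c - dℚ * (b * e)

  B-sym : ∀ x y → B x y ≡ B y x
  B-sym ⟨ a , b ⟩ ⟨ c , e ⟩ = sym-form dℚ a b c e
    where
    sym-form : ∀ d a b c e → a * c - d * (b * e) ≡ c * a - d * (e * b)
    sym-form = RingSolver.solve-∀ ringℚ

  B-linearˡ : ∀ m n x y z → B ((m ·F x) +F (n ·F y)) z ≡ ℤ→ℚ m * B x z + ℤ→ℚ n * B y z
  B-linearˡ m n ⟨ a , b ⟩ ⟨ c , e ⟩ ⟨ f , g ⟩ = linear dℚ (ℤ→ℚ m) (ℤ→ℚ n) a b c e f g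
    where
    linear : ∀ d m n a b c e f g → (m * a + n * c) * f - d * ((m * b + n * e) * g)
                                   ≡ m * (a * f - d * (b * g)) + n * (c * f - d * (e * g))
    linear = RingSolver.solve-∀ ringℚ

  N-polarisation : ∀ x y → N (x +F y) - N (x +F negF y) ≡ (1ℚ + 1ℚ + 1ℚ + 1ℚ) * B x y
  N-polarisation ⟨ a , b ⟩ ⟨ c , e ⟩ = polarisation dℚ a b c e
    where
    polarisation : ∀ d a b c e → ((a + c) * (a + c) - d * ((b + e) * (b + e)))
                                   - ((a + - c) * (a + - c) - d * ((b + - e) * (b + - e)))
                                 ≡ (1ℚ + 1ℚ + 1ℚ + 1ℚ) * (a * c - d * (b * e))
    polarisation = RingSolver.solve-∀ ringℚ

  B-*F : ∀ α x y → B (α *F x) (α *F y) ≡ N α * B x y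
  B-*F ⟨ p , q ⟩ ⟨ a , b ⟩ ⟨ c , e ⟩ = multiplicative dℚ p q a b c e
    where
    multiplicative : ∀ d p q a b c e →
      (p * a + d * (q * b)) * (p * c + d * (q * e)) - d * ((p * b + q * a) * (p * e + q * c))
      ≡ (p * p - d * (q * q)) * (a * c - d * (b * e))
    multiplicative = RingSolver.solve-∀ ringℚ

  detF-*F : ∀ α x y → detF (α *F x) (α *F y) ≡ N α * detF x y
  detF-*F ⟨ p , q ⟩ ⟨ a , b ⟩ ⟨ c , e ⟩ = multiplicative dℚ p q a b c e
    where
    multiplicative : ∀ d p q a b c e → (p * a + d * (q * b)) * (p * e + q * c) - (p * b + q * a) * (p * c + d * (q * e))
                                       ≡ (p * p - d * (q * q)) * (a * e - b * c)
    multiplicative = RingSolver.solve-∀ ringℚ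

  B-√d : ∀ z → B (√d *F z) z ≡ 0ℚ
  B-√d ⟨ c , e ⟩ = vanishes dℚ c e
    where
    vanishes : ∀ d c e → (0ℚ * c + d * (1ℚ * e)) * c - d * ((0ℚ * e + 1ℚ * c) * e) ≡ 0ℚ
    vanishes = RingSolver.solve-∀ ringℚ

  B-½[1+√d] : ∀ z → B (⟨ ½ , ½ ⟩ *F z) z ≡ ½ * N z
  B-½[1+√d] ⟨ c , e ⟩ = half dℚ c e
    where
    half : ∀ d c e → (½ * c + d * (½ * e)) * c - d * ((½ * e + ½ * c) * e) ≡ ½ * (c * c - d * (e * e))
    half = RingSolver.solve-∀ ringℚ

  OrthogonalBasis : List F → F → F → Set
  OrthogonalBasis L x y = ZBasis L x y × B x y ≡ 0ℚ

  orthogonal⇒orthogonalBasis : ∀ {L} → Orthogonal L → ∃₂ (OrthogonalBasis L)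
  orthogonal⇒orthogonalBasis (ρ , ((isometry , _) , _) , x , y , basis , ρx≡x , ρy≡-y) =
    x , y , basis , p≢0∧p*q≡0⇒q≡0 {1ℚ + 1ℚ + 1ℚ + 1ℚ} (λ ()) 4B≡0
    where
    N[x-y]≡N[x+y] : N (x +F negF y) ≡ N (x +F y)
    N[x-y]≡N[x+y] = trans (cong N (sym (trans (app-+F ρ x y) (cong₂ _+F_ ρx≡x ρy≡-y)))) (isometry (x +F y))
    4B≡0 : (1ℚ + 1ℚ + 1ℚ + 1ℚ) * B x y ≡ 0ℚ
    4B≡0 = trans (sym (N-polarisation x y))
             (trans (cong (λ t → N (x +F y) - t) N[x-y]≡N[x+y]) (ℚ.+-inverseʳ (N (x +F y))))

  basis-x≢0 : ∀ {L x y} → ZBasis L x y → x ≢ 0F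
  basis-x≢0 {y = ⟨ c , e ⟩} (_ , _ , det≢0 , _) refl = det≢0 (det-vanishes c e)
    where
    det-vanishes : ∀ c e → 0ℚ * e - 0ℚ * c ≡ 0ℚ
    det-vanishes = RingSolver.solve-∀ ringℚ

  basis-y≢0 : ∀ {L x y} → ZBasis L x y → y ≢ 0F
  basis-y≢0 {x = ⟨ a , b ⟩} (_ , _ , det≢0 , _) refl = det≢0 (det-vanishes a b)
    where
    det-vanishes : ∀ a b → a * 0ℚ - b * 0ℚ ≡ 0ℚ
    det-vanishes = RingSolver.solve-∀ ringℚ

  B-coordinateʳ : ∀ {x y} m n → B x y ≡ 0ℚ → B ((m ·F x) +F (n ·F y)) y ≡ ℤ→ℚ n * N y
  B-coordinateʳ {x} {y} m n Bxy≡0 = begin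
    B ((m ·F x) +F (n ·F y)) y      ≡⟨ B-linearˡ m n x y y ⟩
    ℤ→ℚ m * B x y + ℤ→ℚ n * N y     ≡⟨ cong (λ t → ℤ→ℚ m * t + ℤ→ℚ n * N y) Bxy≡0 ⟩
    ℤ→ℚ m * 0ℚ + ℤ→ℚ n * N y        ≡⟨ drop-zero (ℤ→ℚ m) (ℤ→ℚ n * N y) ⟩
    ℤ→ℚ n * N y                     ∎
    where
    open ≡-Reasoning
    drop-zero : ∀ p q → p * 0ℚ + q ≡ q
    drop-zero = RingSolver.solve-∀ ringℚ

  B-coordinateˡ : ∀ {x y} m n → B x y ≡ 0ℚ → B ((m ·F x) +F (n ·F y)) x ≡ ℤ→ℚ m * N x
  B-coordinateˡ {x} {y} m n Bxy≡0 = begin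
    B ((m ·F x) +F (n ·F y)) x      ≡⟨ B-linearˡ m n x y x ⟩
    ℤ→ℚ m * N x + ℤ→ℚ n * B y x     ≡⟨ cong (λ t → ℤ→ℚ m * N x + ℤ→ℚ n * t) (trans (B-sym y x) Bxy≡0) ⟩
    ℤ→ℚ m * N x + ℤ→ℚ n * 0ℚ        ≡⟨ drop-zero (ℤ→ℚ m * N x) (ℤ→ℚ n) ⟩
    ℤ→ℚ m * N x                     ∎
    where
    open ≡-Reasoning
    drop-zero : ∀ p q → p + q * 0ℚ ≡ p
    drop-zero = RingSolver.solve-∀ ringℚ

  -- z ↦ β z̄
  conjugate-times : F → Lin
  conjugate-times ⟨ u , v ⟩ = mat u (- (dℚ * v)) v (- u)

  N-conjugate-times : ∀ β z → N (app (conjugate-times β) z) ≡ N β * N z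
  N-conjugate-times ⟨ u , v ⟩ ⟨ p , q ⟩ = multiplicative dℚ u v p q
    where
    multiplicative : ∀ d u v p q →
      (u * p + (- (d * v)) * q) * (u * p + (- (d * v)) * q) - d * ((v * p + (- u) * q) * (v * p + (- u) * q))
      ≡ (u * u - d * (v * v)) * (p * p - d * (q * q))
    multiplicative = RingSolver.solve-∀ ringℚ

  det-conjugate-times : ∀ β → det (conjugate-times β) ≡ - N β
  det-conjugate-times ⟨ u , v ⟩ = negated-norm dℚ u v
    where
    negated-norm : ∀ d u v → u * (- u) - (- (d * v)) * v ≡ - (u * u - d * (v * v))
    negated-norm = RingSolver.solve-∀ ringℚ

  -- with i = 1 / N x this is z ↦ (x / x̄) z̄, the reflection in the line ℚx
  reflection : F → ℚ → Lin
  reflection ⟨ a , b ⟩ i = conjugate-times ⟨ (a * a + dℚ * (b * b)) * i , (1ℚ + 1ℚ) * (a * b) * i ⟩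

  module _ {x i} (Nx*i≡1 : N x * i ≡ 1ℚ) where

    private
      β : F
      β = ⟨ (re x * re x + dℚ * (im x * im x)) * i , (1ℚ + 1ℚ) * (re x * im x) * i ⟩

      Nβ≡1 : N β ≡ 1ℚ
      Nβ≡1 = trans (square-of-norm dℚ (re x) (im x) i) (trans (cong (λ t → t * t) Nx*i≡1) (ℚ.*-identityˡ 1ℚ))
        where
        square-of-norm : ∀ d a b i →
          ((a * a + d * (b * b)) * i) * ((a * a + d * (b * b)) * i)
            - d * (((1ℚ + 1ℚ) * (a * b) * i) * ((1ℚ + 1ℚ) * (a * b) * i))
          ≡ ((a * a - d * (b * b)) * i) * ((a * a - d * (b * b)) * i)
        square-of-norm = RingSolver.solve-∀ ringℚ

    reflection-isometry : ∀ z → N (app (reflection x i) z) ≡ N z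
    reflection-isometry z = trans (N-conjugate-times β z) (trans (cong (_* N z) Nβ≡1) (ℚ.*-identityˡ (N z)))

    reflection-det : det (reflection x i) ≡ - 1ℚ
    reflection-det = trans (det-conjugate-times β) (cong -_ Nβ≡1)

    reflection-fixes : app (reflection x i) x ≡ x
    reflection-fixes = cong₂ ⟨_,_⟩
      (trans (re-scaled dℚ (re x) (im x) i) (trans (cong (re x *_) Nx*i≡1) (ℚ.*-identityʳ (re x))))
      (trans (im-scaled dℚ (re x) (im x) i) (trans (cong (im x *_) Nx*i≡1) (ℚ.*-identityʳ (im x))))
      where
      re-scaled : ∀ d a b i → ((a * a + d * (b * b)) * i) * a + (- (d * ((1ℚ + 1ℚ) * (a * b) * i))) * b
                              ≡ a * ((a * a - d * (b * b)) * i)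
      re-scaled = RingSolver.solve-∀ ringℚ
      im-scaled : ∀ d a b i → ((1ℚ + 1ℚ) * (a * b) * i) * a + (- ((a * a + d * (b * b)) * i)) * b
                              ≡ b * ((a * a - d * (b * b)) * i)
      im-scaled = RingSolver.solve-∀ ringℚ

    reflection-negates : ∀ {y} → B x y ≡ 0ℚ → app (reflection x i) y ≡ negF y
    reflection-negates {⟨ c , e ⟩} Bxy≡0 = cong₂ ⟨_,_⟩
      (trans (re-split dℚ (re x) (im x) c e i)
        (trans (cong₂ (λ s t → (1ℚ + 1ℚ) * re x * i * s + (- c) * t) Bxy≡0 Nx*i≡1) (collapse ((1ℚ + 1ℚ) * re x * i) c)))
      (trans (im-split dℚ (re x) (im x) c e i)
        (trans (cong₂ (λ s t → (1ℚ + 1ℚ) * im x * i * s + (- e) * t) Bxy≡0 Nx*i≡1) (collapse ((1ℚ + 1ℚ) * im x * i) e)))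
      where
      re-split : ∀ d a b c e i → ((a * a + d * (b * b)) * i) * c + (- (d * ((1ℚ + 1ℚ) * (a * b) * i))) * e
                                 ≡ (1ℚ + 1ℚ) * a * i * (a * c - d * (b * e)) + (- c) * ((a * a - d * (b * b)) * i)
      re-split = RingSolver.solve-∀ ringℚ
      im-split : ∀ d a b c e i → ((1ℚ + 1ℚ) * (a * b) * i) * c + (- ((a * a + d * (b * b)) * i)) * e
                                 ≡ (1ℚ + 1ℚ) * b * i * (a * c - d * (b * e)) + (- e) * ((a * a - d * (b * b)) * i)
      im-split = RingSolver.solve-∀ ringℚ
      collapse : ∀ s c → s * 0ℚ + (- c) * 1ℚ ≡ - c
      collapse = RingSolver.solve-∀ ringℚ

  reflection-preserves-basis : ∀ {L x y i} → N x * i ≡ 1ℚ → OrthogonalBasis L x y → InOminus L (reflection x i)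
  reflection-preserves-basis {L} {x} {y} {i} Nx*i≡1 ((x∈L , y∈L , _ , coordinates) , Bxy≡0) =
    (reflection-isometry {x} {i} Nx*i≡1 , reflection-det {x} {i} Nx*i≡1) , preserves , onto
    where
    ρ-lincomb : ∀ m k → app (reflection x i) ((m ·F x) +F (k ·F y)) ≡ (m ·F x) +F ((ℤ.- k) ·F y)
    ρ-lincomb m k = trans (app-lincomb (reflection x i) m k x y)
      (cong₂ _+F_ (cong (m ·F_) (reflection-fixes {x} {i} Nx*i≡1))
                  (trans (cong (k ·F_) (reflection-negates {x} {i} Nx*i≡1 Bxy≡0)) (·F-negF k y)))
    preserves : ∀ z → InSpan L z → InSpan L (app (reflection x i) z)
    preserves z z∈L with coordinates z z∈L
    ... | m , k , refl = subst (InSpan L) (sym (ρ-lincomb m k)) (InSpan-lincomb m (ℤ.- k) x∈L y∈L)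
    onto : ∀ z → InSpan L z → ∃ λ w → InSpan L w × app (reflection x i) w ≡ z
    onto z z∈L with coordinates z z∈L
    ... | m , k , refl = (m ·F x) +F ((ℤ.- k) ·F y) , InSpan-lincomb m (ℤ.- k) x∈L y∈L ,
      trans (ρ-lincomb m (ℤ.- k)) (cong (λ t → (m ·F x) +F (t ·F y)) (ℤ.neg-involutive k))

module Imaginary (n : ℕ) where
  open Field -[1+ n ]
  open Arithmetic -[1+ n ]
  open PolarForm -[1+ n ]

  private
    K : ℚ
    K = ℤ→ℚ (+ suc n)

  N-sum-of-squares : ∀ c e → N ⟨ c , e ⟩ ≡ c * c + K * (e * e)
  N-sum-of-squares c e =
    trans (cong (λ t → c * c - t * (e * e)) (ℤ→ℚ-neg (+ suc n))) (double-negation K c e)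
    where
    double-negation : ∀ k c e → c * c - (- k) * (e * e) ≡ c * c + k * (e * e)
    double-negation = RingSolver.solve-∀ ringℚ

  N-definite : ∀ y → N y ≡ 0ℚ → y ≡ 0F
  N-definite ⟨ c , e ⟩ Ny≡0 = cong₂ ⟨_,_⟩ (p*p≡0⇒p≡0 c cc≡0) (p*p≡0⇒p≡0 e ee≡0)
    where
    sum≡0 : c * c + K * (e * e) ≡ 0ℚ
    sum≡0 = trans (sym (N-sum-of-squares c e)) Ny≡0
    0≤Kee : 0ℚ ℚ.≤ K * (e * e)
    0≤Kee = ℚ.nonNegative⁻¹ _ {{ℚ.nonNeg*nonNeg⇒nonNeg K {{ℚ.normalize-nonNeg (suc n) 1}}
                                                          (e * e) {{ℚ.nonNegative (p*p≥0 e)}}}}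
    cc≡0 : c * c ≡ 0ℚ
    cc≡0 = p≥0∧q≥0∧p+q≡0⇒p≡0 (p*p≥0 c) 0≤Kee sum≡0
    K≢0 : K ≢ 0ℚ
    K≢0 K≡0 with ℤ→ℚ-injective {+ suc n} {+ 0} K≡0
    ... | ()
    ee≡0 : e * e ≡ 0ℚ
    ee≡0 = p≢0∧p*q≡0⇒q≡0 K≢0 (p≥0∧q≥0∧p+q≡0⇒p≡0 0≤Kee (p*p≥0 c) (trans (ℚ.+-comm (K * (e * e)) (c * c)) sum≡0))

  N≢0 : ∀ {y} → y ≢ 0F → N y ≢ 0ℚ
  N≢0 y≢0 Ny≡0 = y≢0 (N-definite _ Ny≡0)

  *F-inverseˡ : ∀ {y} → y ≢ 0F → ∃ λ y⁻¹ → y⁻¹ *F y ≡ 1F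
  *F-inverseˡ {y@(⟨ c , e ⟩)} y≢0 =
    ⟨ c * i , - e * i ⟩ , cong₂ ⟨_,_⟩ (trans (re-inverse dℚ c e i) (ℚ.*-inverseʳ (N y))) (im-inverse c e i)
    where
    instance _ = ℚ.≢-nonZero (N≢0 y≢0)
    i = 1/ N y
    re-inverse : ∀ d c e i → (c * i) * c + d * ((- e * i) * e) ≡ (c * c - d * (e * e)) * i
    re-inverse = RingSolver.solve-∀ ringℚ
    im-inverse : ∀ c e i → (c * i) * e + (- e * i) * c ≡ 0ℚ
    im-inverse = RingSolver.solve-∀ ringℚ

  *F-cancelˡ : ∀ {α z w} → α ≢ 0F → α *F z ≡ α *F w → z ≡ w
  *F-cancelˡ {α} {z} {w} α≢0 αz≡αw = begin
    z                 ≡⟨ *F-identityˡ z ⟨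
    1F *F z           ≡⟨ cong (_*F z) α⁻¹α≡1 ⟨
    (α⁻¹ *F α) *F z   ≡⟨ *F-assoc α⁻¹ α z ⟩
    α⁻¹ *F (α *F z)   ≡⟨ cong (α⁻¹ *F_) αz≡αw ⟩
    α⁻¹ *F (α *F w)   ≡⟨ *F-assoc α⁻¹ α w ⟨
    (α⁻¹ *F α) *F w   ≡⟨ cong (_*F w) α⁻¹α≡1 ⟩
    1F *F w           ≡⟨ *F-identityˡ w ⟩
    w                 ∎
    where
    open ≡-Reasoning
    α⁻¹ = proj₁ (*F-inverseˡ α≢0)
    α⁻¹α≡1 = proj₂ (*F-inverseˡ α≢0)

  *F-cancelʳ : ∀ {α z w} → α ≢ 0F → z *F α ≡ w *F α → z ≡ w
  *F-cancelʳ {α} {z} {w} α≢0 zα≡wα = *F-cancelˡ α≢0 (trans (*F-comm α z) (trans zα≡wα (*F-comm w α)))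

  orthogonalBasis⇒orthogonal : ∀ {L x y} → OrthogonalBasis L x y → Orthogonal L
  orthogonalBasis⇒orthogonal {L} {x} {y} ob@(basis , Bxy≡0) = via-inverse (ℚ-inverseʳ (N≢0 (basis-x≢0 basis)))
    where
    via-inverse : (∃ λ i → N x * i ≡ 1ℚ) → Orthogonal L
    via-inverse (i , Nx*i≡1) = reflection x i , reflection-preserves-basis {L} {x} {y} {i} Nx*i≡1 ob ,
      x , y , basis , reflection-fixes {x} {i} Nx*i≡1 , reflection-negates {x} {i} Nx*i≡1 Bxy≡0

  orthogonalBasis-⊥y : ∀ {L x y z} → OrthogonalBasis L x y → InSpan L z → B z y ≡ 0ℚ → ∃ λ m → z ≡ m ·F x
  orthogonalBasis-⊥y {x = x} {y} (basis@(_ , _ , _ , coordinates) , Bxy≡0) z∈L Bzy≡0 with coordinates _ z∈L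
  ... | m , k , refl = m , trans (cong (λ t → (m ·F x) +F (t ·F y)) k≡0)
                               (trans (cong ((m ·F x) +F_) (·F-zeroˡ y)) (+F-identityʳ (m ·F x)))
    where
    k≡0 : k ≡ + 0
    k≡0 = ℤ→ℚ-injective (q≢0∧p*q≡0⇒p≡0 (N≢0 (basis-y≢0 basis)) (trans (sym (B-coordinateʳ m k Bxy≡0)) Bzy≡0))

  orthogonalBasis-⊥x : ∀ {L x y z} → OrthogonalBasis L x y → InSpan L z → B z x ≡ 0ℚ → ∃ λ k → z ≡ k ·F y
  orthogonalBasis-⊥x {x = x} {y} (basis@(_ , _ , _ , coordinates) , Bxy≡0) z∈L Bzx≡0 with coordinates _ z∈L
  ... | m , k , refl = k , trans (cong (λ t → (t ·F x) +F (k ·F y)) m≡0)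
                               (trans (cong (_+F (k ·F y)) (·F-zeroˡ x)) (+F-identityˡ (k ·F y)))
    where
    m≡0 : m ≡ + 0
    m≡0 = ℤ→ℚ-injective (q≢0∧p*q≡0⇒p≡0 (N≢0 (basis-x≢0 basis)) (trans (sym (B-coordinateˡ m k Bxy≡0)) Bzx≡0))

  ¬orthogonal-if-ω≡½[1+√d] : ω ≡ ⟨ ½ , ½ ⟩ → (I : FracIdeal) → ¬ Orthogonal (gens I)
  ¬orthogonal-if-ω≡½[1+√d] ω≡½[1+√d] I orthogonal = no-basis (orthogonal⇒orthogonalBasis orthogonal)
    where
    no-basis : ¬ ∃₂ (OrthogonalBasis (gens I))
    no-basis (x , y , basis@(_ , y∈I , _ , coordinates) , Bxy≡0) = no-coordinates (coordinates _ ωy∈I)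
      where
      ωy∈I : InSpan (gens I) (⟨ ½ , ½ ⟩ *F y)
      ωy∈I = subst (λ t → InSpan (gens I) (t *F y)) ω≡½[1+√d] (ωclosed I y y∈I)
      no-coordinates : ¬ ∃₂ λ m k → ⟨ ½ , ½ ⟩ *F y ≡ (m ·F x) +F (k ·F y)
      no-coordinates (m , k , ωy≡mx+ky) = ½≢ℤ→ℚ k (*-cancelʳ-≡ (N≢0 (basis-y≢0 basis))
        (trans (sym (B-½[1+√d] y)) (trans (cong (λ t → B t y) ωy≡mx+ky) (B-coordinateʳ m k Bxy≡0))))

module Lattices (d : ℤ) where
  open Field d
  open Arithmetic d
  open PolarForm d

  pt : ℤ → ℤ → F
  pt P Q = ⟨ ℤ→ℚ P , ℤ→ℚ Q ⟩

  pt-+ : ∀ P Q P′ Q′ → pt P Q +F pt P′ Q′ ≡ pt (P ℤ.+ P′) (Q ℤ.+ Q′)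
  pt-+ P Q P′ Q′ = cong₂ ⟨_,_⟩ (sym (ℤ→ℚ-+ P P′)) (sym (ℤ→ℚ-+ Q Q′))

  pt-· : ∀ m P Q → m ·F pt P Q ≡ pt (m ℤ.* P) (m ℤ.* Q)
  pt-· m P Q = cong₂ ⟨_,_⟩ (sym (ℤ→ℚ-* m P)) (sym (ℤ→ℚ-* m Q))

  pt-* : ∀ P Q P′ Q′ → pt P Q *F pt P′ Q′ ≡ pt (P ℤ.* P′ ℤ.+ d ℤ.* (Q ℤ.* Q′)) (P ℤ.* Q′ ℤ.+ Q ℤ.* P′)
  pt-* P Q P′ Q′ = cong₂ ⟨_,_⟩
    (sym (trans (ℤ→ℚ-+ (P ℤ.* P′) (d ℤ.* (Q ℤ.* Q′)))
                (cong₂ _+_ (ℤ→ℚ-* P P′) (trans (ℤ→ℚ-* d (Q ℤ.* Q′)) (cong (dℚ *_) (ℤ→ℚ-* Q Q′))))))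
    (sym (trans (ℤ→ℚ-+ (P ℤ.* Q′) (Q ℤ.* P′)) (cong₂ _+_ (ℤ→ℚ-* P Q′) (ℤ→ℚ-* Q P′))))

  pt-lincomb : ∀ U V P Q P′ Q′ →
               (U ·F pt P Q) +F (V ·F pt P′ Q′) ≡ pt (U ℤ.* P ℤ.+ V ℤ.* P′) (U ℤ.* Q ℤ.+ V ℤ.* Q′)
  pt-lincomb U V P Q P′ Q′ =
    trans (cong₂ _+F_ (pt-· U P Q) (pt-· V P′ Q′)) (pt-+ (U ℤ.* P) (U ℤ.* Q) (V ℤ.* P′) (V ℤ.* Q′))

  pt-injective : ∀ {P Q P′ Q′} → pt P Q ≡ pt P′ Q′ → P ≡ P′ × Q ≡ Q′
  pt-injective eq = ℤ→ℚ-injective (cong re eq) , ℤ→ℚ-injective (cong im eq)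

  pt-*F : ∀ m z → pt m (+ 0) *F z ≡ m ·F z
  pt-*F m ⟨ a , b ⟩ = cong₂ ⟨_,_⟩ (re-scalar dℚ (ℤ→ℚ m) a b) (im-scalar (ℤ→ℚ m) a b)
    where
    re-scalar : ∀ d m a b → m * a + d * (0ℚ * b) ≡ m * a
    re-scalar = RingSolver.solve-∀ ringℚ
    im-scalar : ∀ m a b → m * b + 0ℚ * a ≡ m * b
    im-scalar = RingSolver.solve-∀ ringℚ

  √d*√d : √d *F √d ≡ pt d (+ 0)
  √d*√d = trans (pt-* (+ 0) (+ 1) (+ 0) (+ 1)) (cong (λ P → pt P (+ 0)) (re-identity d))
    where
    re-identity : ∀ d → + 0 ℤ.* + 0 ℤ.+ d ℤ.* (+ 1 ℤ.* + 1) ≡ d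
    re-identity = solve-∀

  detF-pt : ∀ P Q P′ Q′ → detF (pt P Q) (pt P′ Q′) ≡ ℤ→ℚ (P ℤ.* Q′ ℤ.- Q ℤ.* P′)
  detF-pt P Q P′ Q′ = sym (trans (ℤ→ℚ-+ (P ℤ.* Q′) (ℤ.- (Q ℤ.* P′)))
    (cong₂ _+_ (ℤ→ℚ-* P Q′) (trans (ℤ→ℚ-neg (Q ℤ.* P′)) (cong -_ (ℤ→ℚ-* Q P′)))))

  B-pt : ∀ P Q P′ Q′ → B (pt P Q) (pt P′ Q′) ≡ ℤ→ℚ (P ℤ.* P′ ℤ.- d ℤ.* (Q ℤ.* Q′))
  B-pt P Q P′ Q′ = sym (trans (ℤ→ℚ-+ (P ℤ.* P′) (ℤ.- (d ℤ.* (Q ℤ.* Q′))))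
    (cong₂ _+_ (ℤ→ℚ-* P P′) (trans (ℤ→ℚ-neg (d ℤ.* (Q ℤ.* Q′)))
      (cong -_ (trans (ℤ→ℚ-* d (Q ℤ.* Q′)) (cong (dℚ *_) (ℤ→ℚ-* Q Q′)))))))

  -- the basis k m, k √d, in the form in which SpansLattice.complete produces it
  latticeBasis₁ latticeBasis₂ : ℤ → ℤ → F
  latticeBasis₁ k m = pt (k ℤ.* m ℤ.* + 1) (k ℤ.* + 0)
  latticeBasis₂ k m = pt (k ℤ.* m ℤ.* + 0) (k ℤ.* + 1)

  latticeBasis-lincomb : ∀ k m U V →
    (U ·F latticeBasis₁ k m) +F (V ·F latticeBasis₂ k m) ≡ pt (k ℤ.* m ℤ.* U) (k ℤ.* V)
  latticeBasis-lincomb k m U V =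
    trans (pt-lincomb U V (k ℤ.* m ℤ.* + 1) (k ℤ.* + 0) (k ℤ.* m ℤ.* + 0) (k ℤ.* + 1))
          (cong₂ pt (re-identity k m U V) (im-identity k U V))
    where
    re-identity : ∀ k m U V → U ℤ.* (k ℤ.* m ℤ.* + 1) ℤ.+ V ℤ.* (k ℤ.* m ℤ.* + 0) ≡ k ℤ.* m ℤ.* U
    re-identity = solve-∀
    im-identity : ∀ k U V → U ℤ.* (k ℤ.* + 0) ℤ.+ V ℤ.* (k ℤ.* + 1) ≡ k ℤ.* V
    im-identity = solve-∀

  detF-latticeBasis : ∀ k m → detF (latticeBasis₁ k m) (latticeBasis₂ k m) ≡ ℤ→ℚ (k ℤ.* k ℤ.* m)
  detF-latticeBasis k m = trans (detF-pt (k ℤ.* m ℤ.* + 1) (k ℤ.* + 0) (k ℤ.* m ℤ.* + 0) (k ℤ.* + 1))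
                                (cong ℤ→ℚ (det-identity k m))
    where
    det-identity : ∀ k m → k ℤ.* m ℤ.* + 1 ℤ.* (k ℤ.* + 1) ℤ.- k ℤ.* + 0 ℤ.* (k ℤ.* m ℤ.* + 0) ≡ k ℤ.* k ℤ.* m
    det-identity = solve-∀

  B-latticeBasis : ∀ k m → B (latticeBasis₁ k m) (latticeBasis₂ k m) ≡ 0ℚ
  B-latticeBasis k m = trans (B-pt (k ℤ.* m ℤ.* + 1) (k ℤ.* + 0) (k ℤ.* m ℤ.* + 0) (k ℤ.* + 1))
                             (cong ℤ→ℚ (B-identity d k m))
    where
    B-identity : ∀ d k m → k ℤ.* m ℤ.* + 1 ℤ.* (k ℤ.* m ℤ.* + 0) ℤ.- d ℤ.* (k ℤ.* + 0 ℤ.* (k ℤ.* + 1)) ≡ + 0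
    B-identity = solve-∀

  -- G spans the lattice k (m ℤ + ℤ √d)
  record SpansLattice (G : List F) (k m : ℤ) : Set where
    field
      sound    : ∀ {z} → InSpan G z → ∃₂ λ U V → z ≡ pt (k ℤ.* m ℤ.* U) (k ℤ.* V)
      complete : ∀ U V → InSpan G (pt (k ℤ.* m ℤ.* U) (k ℤ.* V))

  -- r (k m U₁ + k V₁ √d) + √d (k m U₂ + k V₂ √d) = k′ m′ U + k′ V √d
  Combines : (r k m k′ m′ U₁ V₁ U₂ V₂ U V : ℤ) → Set
  Combines r k m k′ m′ U₁ V₁ U₂ V₂ U V =
    (r ℤ.* (k ℤ.* m ℤ.* U₁) ℤ.+ d ℤ.* (k ℤ.* V₂) ≡ k′ ℤ.* m′ ℤ.* U) × (r ℤ.* (k ℤ.* V₁) ℤ.+ k ℤ.* m ℤ.* U₂ ≡ k′ ℤ.* V)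

  record LatticeStep (r k m k′ m′ : ℤ) : Set where
    field
      forward  : ∀ U₁ V₁ U₂ V₂ → ∃₂ λ U V → Combines r k m k′ m′ U₁ V₁ U₂ V₂ U V
      backward : ∀ U V → ∃₂ λ U₁ V₁ → ∃₂ λ U₂ V₂ → Combines r k m k′ m′ U₁ V₁ U₂ V₂ U V

  Pr-combination : ∀ r P₁ Q₁ P₂ Q₂ → (pt (+ r) (+ 0) *F pt P₁ Q₁) +F (√d *F pt P₂ Q₂)
                                     ≡ pt (+ r ℤ.* P₁ ℤ.+ d ℤ.* Q₂) (+ r ℤ.* Q₁ ℤ.+ P₂)
  Pr-combination r P₁ Q₁ P₂ Q₂ =
    trans (cong₂ _+F_ (pt-* (+ r) (+ 0) P₁ Q₁) (pt-* (+ 0) (+ 1) P₂ Q₂))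
          (trans (pt-+ (+ r ℤ.* P₁ ℤ.+ d ℤ.* (+ 0 ℤ.* Q₁)) (+ r ℤ.* Q₁ ℤ.+ + 0 ℤ.* P₁)
                       (+ 0 ℤ.* P₂ ℤ.+ d ℤ.* (+ 1 ℤ.* Q₂)) (+ 0 ℤ.* Q₂ ℤ.+ + 1 ℤ.* P₂))
                 (cong₂ pt (re-simplify (+ r) P₁ Q₁ P₂ Q₂ d) (im-simplify (+ r) P₁ Q₁ P₂ Q₂)))
    where
    re-simplify : ∀ r P₁ Q₁ P₂ Q₂ d → r ℤ.* P₁ ℤ.+ d ℤ.* (+ 0 ℤ.* Q₁) ℤ.+ (+ 0 ℤ.* P₂ ℤ.+ d ℤ.* (+ 1 ℤ.* Q₂))
                                      ≡ r ℤ.* P₁ ℤ.+ d ℤ.* Q₂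
    re-simplify = solve-∀
    im-simplify : ∀ r P₁ Q₁ P₂ Q₂ → r ℤ.* Q₁ ℤ.+ + 0 ℤ.* P₁ ℤ.+ (+ 0 ℤ.* Q₂ ℤ.+ + 1 ℤ.* P₂) ≡ r ℤ.* Q₁ ℤ.+ P₂
    im-simplify = solve-∀

  spansLattice-Pr : ∀ {r G k m k′ m′} → LatticeStep (+ r) k m k′ m′ →
                    SpansLattice G k m → SpansLattice (prodGens (Pr r) G) k′ m′
  spansLattice-Pr {r} {G} {k} {m} {k′} {m′} step spans = record { sound = sound′ ; complete = complete′ }
    where
    open SpansLattice spans
    open LatticeStep step
    sound′ : ∀ {z} → InSpan (prodGens (Pr r) G) z → ∃₂ λ U V → z ≡ pt (k′ ℤ.* m′ ℤ.* U) (k′ ℤ.* V)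
    sound′ z∈PG with InSpan-prodGens₂⁻ (pt (+ r) (+ 0)) √d G z∈PG
    ... | w₁ , w₂ , w₁∈G , w₂∈G , refl with sound w₁∈G | sound w₂∈G
    ... | U₁ , V₁ , refl | U₂ , V₂ , refl with forward U₁ V₁ U₂ V₂
    ... | U , V , re≡ , im≡ =
      U , V , trans (Pr-combination r (k ℤ.* m ℤ.* U₁) (k ℤ.* V₁) (k ℤ.* m ℤ.* U₂) (k ℤ.* V₂)) (cong₂ pt re≡ im≡)
    complete′ : ∀ U V → InSpan (prodGens (Pr r) G) (pt (k′ ℤ.* m′ ℤ.* U) (k′ ℤ.* V))
    complete′ U V with backward U V
    ... | U₁ , V₁ , U₂ , V₂ , re≡ , im≡ =
      subst (InSpan (prodGens (Pr r) G))
        (trans (Pr-combination r (k ℤ.* m ℤ.* U₁) (k ℤ.* V₁) (k ℤ.* m ℤ.* U₂) (k ℤ.* V₂)) (cong₂ pt re≡ im≡))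
        (InSpan-prodGens₂⁺ (pt (+ r) (+ 0)) √d G (complete U₁ V₁) (complete U₂ V₂))

  latticeStep-coprime : ∀ {r k m e s t} → d ≡ ℤ.- (e ℤ.* (r ℤ.* m)) → s ℤ.* r ℤ.+ t ℤ.* m ≡ + 1 →
                        LatticeStep r k m k (r ℤ.* m)
  latticeStep-coprime {r} {k} {m} {e} {s} {t} d≡-erm sr+tm≡1 = record { forward = forward ; backward = backward }
    where
    forward : ∀ U₁ V₁ U₂ V₂ → ∃₂ λ U V → Combines r k m k (r ℤ.* m) U₁ V₁ U₂ V₂ U V
    forward U₁ V₁ U₂ V₂ = U₁ ℤ.- e ℤ.* V₂ , r ℤ.* V₁ ℤ.+ m ℤ.* U₂ ,
      trans (cong (λ δ → r ℤ.* (k ℤ.* m ℤ.* U₁) ℤ.+ δ ℤ.* (k ℤ.* V₂)) d≡-erm) (re-identity e r m k U₁ V₂) ,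
      im-identity r m k V₁ U₂
      where
      re-identity : ∀ e r m k U₁ V₂ → r ℤ.* (k ℤ.* m ℤ.* U₁) ℤ.+ ℤ.- (e ℤ.* (r ℤ.* m)) ℤ.* (k ℤ.* V₂)
                                      ≡ k ℤ.* (r ℤ.* m) ℤ.* (U₁ ℤ.- e ℤ.* V₂)
      re-identity = solve-∀
      im-identity : ∀ r m k V₁ U₂ → r ℤ.* (k ℤ.* V₁) ℤ.+ k ℤ.* m ℤ.* U₂ ≡ k ℤ.* (r ℤ.* V₁ ℤ.+ m ℤ.* U₂)
      im-identity = solve-∀
    backward : ∀ U V → ∃₂ λ U₁ V₁ → ∃₂ λ U₂ V₂ → Combines r k m k (r ℤ.* m) U₁ V₁ U₂ V₂ U V
    backward U V = U , V ℤ.* s , V ℤ.* t , + 0 ,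
      trans (cong (λ δ → r ℤ.* (k ℤ.* m ℤ.* U) ℤ.+ δ ℤ.* (k ℤ.* + 0)) d≡-erm) (re-identity e r m k U) ,
      trans (im-identity r m k V s t) (trans (cong (k ℤ.* V ℤ.*_) sr+tm≡1) (ℤ.*-identityʳ (k ℤ.* V)))
      where
      re-identity : ∀ e r m k U → r ℤ.* (k ℤ.* m ℤ.* U) ℤ.+ ℤ.- (e ℤ.* (r ℤ.* m)) ℤ.* (k ℤ.* + 0) ≡ k ℤ.* (r ℤ.* m) ℤ.* U
      re-identity = solve-∀
      im-identity : ∀ r m k V s t → r ℤ.* (k ℤ.* (V ℤ.* s)) ℤ.+ k ℤ.* m ℤ.* (V ℤ.* t) ≡ k ℤ.* V ℤ.* (s ℤ.* r ℤ.+ t ℤ.* m)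
      im-identity = solve-∀

  latticeStep-divisible : ∀ {r k m′ e s t} → d ≡ ℤ.- (e ℤ.* (m′ ℤ.* r)) → s ℤ.* r ℤ.+ t ℤ.* e ≡ + 1 →
                          LatticeStep r k (m′ ℤ.* r) (k ℤ.* r) m′
  latticeStep-divisible {r} {k} {m′} {e} {s} {t} d≡-em′r sr+te≡1 = record { forward = forward ; backward = backward }
    where
    forward : ∀ U₁ V₁ U₂ V₂ → ∃₂ λ U V → Combines r k (m′ ℤ.* r) (k ℤ.* r) m′ U₁ V₁ U₂ V₂ U V
    forward U₁ V₁ U₂ V₂ = r ℤ.* U₁ ℤ.- e ℤ.* V₂ , V₁ ℤ.+ m′ ℤ.* U₂ ,
      trans (cong (λ δ → r ℤ.* (k ℤ.* (m′ ℤ.* r) ℤ.* U₁) ℤ.+ δ ℤ.* (k ℤ.* V₂)) d≡-em′r) (re-identity e r m′ k U₁ V₂) ,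
      im-identity r m′ k V₁ U₂
      where
      re-identity : ∀ e r m′ k U₁ V₂ → r ℤ.* (k ℤ.* (m′ ℤ.* r) ℤ.* U₁) ℤ.+ ℤ.- (e ℤ.* (m′ ℤ.* r)) ℤ.* (k ℤ.* V₂)
                                       ≡ k ℤ.* r ℤ.* m′ ℤ.* (r ℤ.* U₁ ℤ.- e ℤ.* V₂)
      re-identity = solve-∀
      im-identity : ∀ r m′ k V₁ U₂ → r ℤ.* (k ℤ.* V₁) ℤ.+ k ℤ.* (m′ ℤ.* r) ℤ.* U₂ ≡ k ℤ.* r ℤ.* (V₁ ℤ.+ m′ ℤ.* U₂)
      im-identity = solve-∀
    backward : ∀ U V → ∃₂ λ U₁ V₁ → ∃₂ λ U₂ V₂ → Combines r k (m′ ℤ.* r) (k ℤ.* r) m′ U₁ V₁ U₂ V₂ U V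
    backward U V = s ℤ.* U , V , + 0 , ℤ.- (t ℤ.* U) ,
      trans (cong (λ δ → r ℤ.* (k ℤ.* (m′ ℤ.* r) ℤ.* (s ℤ.* U)) ℤ.+ δ ℤ.* (k ℤ.* ℤ.- (t ℤ.* U))) d≡-em′r)
        (trans (re-identity e r m′ k s t U)
          (trans (cong (k ℤ.* r ℤ.* m′ ℤ.* U ℤ.*_) sr+te≡1) (ℤ.*-identityʳ (k ℤ.* r ℤ.* m′ ℤ.* U)))) ,
      im-identity r m′ k V
      where
      re-identity : ∀ e r m′ k s t U →
        r ℤ.* (k ℤ.* (m′ ℤ.* r) ℤ.* (s ℤ.* U)) ℤ.+ ℤ.- (e ℤ.* (m′ ℤ.* r)) ℤ.* (k ℤ.* ℤ.- (t ℤ.* U))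
        ≡ k ℤ.* r ℤ.* m′ ℤ.* U ℤ.* (s ℤ.* r ℤ.+ t ℤ.* e)
      re-identity = solve-∀
      im-identity : ∀ r m′ k V → r ℤ.* (k ℤ.* V) ℤ.+ k ℤ.* (m′ ℤ.* r) ℤ.* + 0 ≡ k ℤ.* r ℤ.* V
      im-identity = solve-∀

  spansLattice-𝒪 : ω ≡ √d → SpansLattice OFgens (+ 1) (+ 1)
  spansLattice-𝒪 ω≡√d = record { sound = sound ; complete = complete }
    where
    coordinates : ∀ U V → (U ·F 1F) +F ((V ·F ω) +F 0F) ≡ pt (+ 1 ℤ.* + 1 ℤ.* U) (+ 1 ℤ.* V)
    coordinates U V = begin
      (U ·F 1F) +F ((V ·F ω) +F 0F)          ≡⟨ cong (λ t → (U ·F 1F) +F t) (+F-identityʳ (V ·F ω)) ⟩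
      (U ·F pt (+ 1) (+ 0)) +F (V ·F ω)      ≡⟨ cong (λ t → (U ·F pt (+ 1) (+ 0)) +F (V ·F t)) ω≡√d ⟩
      (U ·F pt (+ 1) (+ 0)) +F (V ·F pt (+ 0) (+ 1))
        ≡⟨ pt-lincomb U V (+ 1) (+ 0) (+ 0) (+ 1) ⟩
      pt (U ℤ.* + 1 ℤ.+ V ℤ.* + 0) (U ℤ.* + 0 ℤ.+ V ℤ.* + 1)
        ≡⟨ cong₂ pt (re-identity U V) (im-identity U V) ⟩
      pt (+ 1 ℤ.* + 1 ℤ.* U) (+ 1 ℤ.* V)    ∎
      where
      open ≡-Reasoning
      re-identity : ∀ U V → U ℤ.* + 1 ℤ.+ V ℤ.* + 0 ≡ + 1 ℤ.* + 1 ℤ.* U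
      re-identity = solve-∀
      im-identity : ∀ U V → U ℤ.* + 0 ℤ.+ V ℤ.* + 1 ≡ + 1 ℤ.* V
      im-identity = solve-∀
    sound : ∀ {z} → InSpan OFgens z → ∃₂ λ U V → z ≡ pt (+ 1 ℤ.* + 1 ℤ.* U) (+ 1 ℤ.* V)
    sound (cons U (cons V nil)) = U , V , coordinates U V
    complete : ∀ U V → InSpan OFgens (pt (+ 1 ℤ.* + 1 ℤ.* U) (+ 1 ℤ.* V))
    complete U V = subst (InSpan OFgens) (coordinates U V) (cons U (cons V nil))

module RamifiedProducts (n : ℕ) (squarefree : SquareFree -[1+ n ])
                        (ω≡√d : Field.ω -[1+ n ] ≡ Field.√d -[1+ n ]) where
  open Field -[1+ n ]
  open Lattices -[1+ n ]

  ramifiedProduct : List ℕ → List F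
  ramifiedProduct rs = prodAll (map Pr rs)

  record RamifiedLattice (rs : List ℕ) : Set where
    field
      k m     : ℕ
      k*k*m≡∏ : k ℕ.* k ℕ.* m ≡ product rs
      m∣d     : m ∣ suc n
      spans   : SpansLattice (ramifiedProduct rs) (+ k) (+ m)

  ramifiedLattice-[] : RamifiedLattice []
  ramifiedLattice-[] = record { k = 1 ; m = 1 ; k*k*m≡∏ = refl ; m∣d = 1∣ suc n ; spans = spansLattice-𝒪 ω≡√d }

  ramifiedLattice-∷-coprime : ∀ {r rs} → Prime r → r ∣ suc n → (L : RamifiedLattice rs) →
                              ¬ r ∣ RamifiedLattice.m L → RamifiedLattice (r ∷ rs)
  ramifiedLattice-∷-coprime {r} {rs} r-prime r∣D L r∤m = record
    { k = k ; m = r ℕ.* m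
    ; k*k*m≡∏ = trans (rearrange k r m) (cong (r ℕ.*_) k*k*m≡∏)
    ; m∣d = divides e′ D≡e′rm
    ; spans = subst (SpansLattice (ramifiedProduct (r ∷ rs)) (+ k)) (sym (ℤ.pos-* r m))
                (spansLattice-Pr (latticeStep-coprime {+ r} {+ k} {+ m} {+ e′} {s} {t}
                                    (-[D]≡-[e*a*b] {suc n} {e′} {r} {m} D≡e′rm) sr+tm≡1)
                                 spans)
    }
    where
    open RamifiedLattice L
    e = quotient m∣d
    r⊥m = prime∤⇒coprime r-prime r∤m
    r∣e : r ∣ e
    r∣e = coprime-divisor r⊥m (subst (r ∣_) (trans (_∣_.equality m∣d) (ℕ.*-comm e m)) r∣D)
    e′ = quotient r∣e
    D≡e′rm : suc n ≡ e′ ℕ.* (r ℕ.* m)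
    D≡e′rm = trans (_∣_.equality m∣d) (trans (cong (ℕ._* m) (_∣_.equality r∣e)) (ℕ.*-assoc e′ r m))
    s = proj₁ (coprime⇒ℤ-bézout r⊥m)
    t = proj₁ (proj₂ (coprime⇒ℤ-bézout r⊥m))
    sr+tm≡1 = proj₂ (proj₂ (coprime⇒ℤ-bézout r⊥m))
    rearrange : ∀ k r m → k ℕ.* k ℕ.* (r ℕ.* m) ≡ r ℕ.* (k ℕ.* k ℕ.* m)
    rearrange = ℕ-Solver.solve-∀

  ramifiedLattice-∷-divisible : ∀ {r rs m′} → Prime r → (L : RamifiedLattice rs) →
                                RamifiedLattice.m L ≡ m′ ℕ.* r → RamifiedLattice (r ∷ rs)
  ramifiedLattice-∷-divisible {r} {rs} {m′} r-prime L m≡m′r = record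
    { k = k ℕ.* r ; m = m′
    ; k*k*m≡∏ = trans (rearrange k r m′) (cong (r ℕ.*_) (trans (cong (k ℕ.* k ℕ.*_) (sym m≡m′r)) k*k*m≡∏))
    ; m∣d = divides (e ℕ.* r) (trans D≡em′r (regroup e m′ r))
    ; spans = subst (λ k′ → SpansLattice (ramifiedProduct (r ∷ rs)) k′ (+ m′)) (sym (ℤ.pos-* k r))
                (spansLattice-Pr (latticeStep-divisible {+ r} {+ k} {+ m′} {+ e} {s} {t}
                                    (-[D]≡-[e*a*b] {suc n} {e} {m′} {r} D≡em′r) sr+te≡1)
                                 (subst (SpansLattice (ramifiedProduct rs) (+ k))
                                        (trans (cong +_ m≡m′r) (ℤ.pos-* m′ r)) spans))
    }
    where
    open RamifiedLattice L
    rearrange : ∀ k r m′ → k ℕ.* r ℕ.* (k ℕ.* r) ℕ.* m′ ≡ r ℕ.* (k ℕ.* k ℕ.* (m′ ℕ.* r))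
    rearrange = ℕ-Solver.solve-∀
    regroup : ∀ e m′ r → e ℕ.* (m′ ℕ.* r) ≡ e ℕ.* r ℕ.* m′
    regroup = ℕ-Solver.solve-∀
    square-out : ∀ e′ m′ r → e′ ℕ.* r ℕ.* (m′ ℕ.* r) ≡ e′ ℕ.* m′ ℕ.* (r ℕ.* r)
    square-out = ℕ-Solver.solve-∀
    e = quotient m∣d
    D≡em′r : suc n ≡ e ℕ.* (m′ ℕ.* r)
    D≡em′r = trans (_∣_.equality m∣d) (cong (e ℕ.*_) m≡m′r)
    r∤e : ¬ r ∣ e
    r∤e (divides e′ e≡e′r) = prime⇒≢1 r-prime (squarefree r (divides (e′ ℕ.* m′)
      (trans D≡em′r (trans (cong (ℕ._* (m′ ℕ.* r)) e≡e′r) (square-out e′ m′ r)))))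
    r⊥e = prime∤⇒coprime r-prime r∤e
    s = proj₁ (coprime⇒ℤ-bézout r⊥e)
    t = proj₁ (proj₂ (coprime⇒ℤ-bézout r⊥e))
    sr+te≡1 = proj₂ (proj₂ (coprime⇒ℤ-bézout r⊥e))

  ramifiedLattice-∷ : ∀ {r rs} → Prime r → r ∣ suc n → RamifiedLattice rs → RamifiedLattice (r ∷ rs)
  ramifiedLattice-∷ {r} r-prime r∣D L with r ∣? RamifiedLattice.m L
  ... | yes (divides m′ m≡m′r) = ramifiedLattice-∷-divisible {m′ = m′} r-prime L m≡m′r
  ... | no r∤m                 = ramifiedLattice-∷-coprime r-prime r∣D L r∤m

  ramifiedLattice : ∀ rs → All (λ r → Prime r × r ∣ suc n) rs → RamifiedLattice rs
  ramifiedLattice []       []                       = ramifiedLattice-[]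
  ramifiedLattice (r ∷ rs) ((r-prime , r∣D) ∷ rs-ok) = ramifiedLattice-∷ r-prime r∣D (ramifiedLattice rs rs-ok)

  ramifiedLattice-of-divisor : ∀ {c} → c ≢ 0 → c ∣ suc n →
    ∃ λ rs → All (λ r → Prime r × r ∣ suc n) rs × SpansLattice (ramifiedProduct rs) (+ 1) (+ c)
  ramifiedLattice-of-divisor {c} c≢0 c∣D =
    rs , rs-ok , subst₂ (SpansLattice (ramifiedProduct rs)) (cong +_ k≡1) (cong +_ m≡c) spans
    where
    open PrimeFactorisation (factorise c {{ℕ.≢-nonZero c≢0}})
    rs = factors
    rs-ok : All (λ r → Prime r × r ∣ suc n) rs
    rs-ok = All.tabulate (λ r∈rs → All.lookup factorsPrime r∈rs ,
                                   ∣-trans (∈⇒∣product r∈rs) (subst (_∣ suc n) isFactorisation c∣D))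
    open RamifiedLattice (ramifiedLattice rs rs-ok)
    k*k*m≡c : k ℕ.* k ℕ.* m ≡ c
    k*k*m≡c = trans k*k*m≡∏ (sym isFactorisation)
    k≡1 : k ≡ 1
    k≡1 = squarefree k (∣-trans (divides m (trans (sym k*k*m≡c) (ℕ.*-comm (k ℕ.* k) m))) c∣D)
    m≡c : m ≡ c
    m≡c = trans (sym (ℕ.*-identityˡ m)) (trans (cong (λ t → t ℕ.* t ℕ.* m) (sym k≡1)) k*k*m≡c)

module Classification (n : ℕ) (squarefree : SquareFree -[1+ n ])
                      (ω≡√d : Field.ω -[1+ n ] ≡ Field.√d -[1+ n ]) where
  open Field -[1+ n ]
  open Arithmetic -[1+ n ]
  open PolarForm -[1+ n ]
  open Imaginary n
  open Lattices -[1+ n ]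
  open RamifiedProducts n squarefree ω≡√d

  ramifiedClass⇒orthogonal : ∀ L → ProdOfRamifiedClasses L → Orthogonal L
  ramifiedClass⇒orthogonal L (rs , rs-ok , α , α≢0 , J⊆αL , αL⊆J) =
    from-preimages (J⊆αL e₁ (complete (+ 1) (+ 0))) (J⊆αL e₂ (complete (+ 0) (+ 1)))
    where
    open RamifiedLattice (ramifiedLattice rs rs-ok)
    open SpansLattice spans
    e₁ e₂ : F
    e₁ = latticeBasis₁ (+ k) (+ m)
    e₂ = latticeBasis₂ (+ k) (+ m)
    k*k*m≢0 : + k ℤ.* + k ℤ.* + m ≢ + 0
    k*k*m≢0 k*k*m≡0 = ℕ.≢-nonZero⁻¹ (product rs) {{productOfPrimes≢0 (All.map proj₁ rs-ok)}}
      (trans (sym k*k*m≡∏) (ℤ.+-injective (trans (ℤ.pos-* (k ℕ.* k) m) (trans (cong (ℤ._* + m) (ℤ.pos-* k k)) k*k*m≡0))))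
    from-preimages : (∃ λ x → InSpan L x × e₁ ≡ α *F x) → (∃ λ y → InSpan L y × e₂ ≡ α *F y) → Orthogonal L
    from-preimages (x , x∈L , e₁≡αx) (y , y∈L , e₂≡αy) =
      orthogonalBasis⇒orthogonal ((x∈L , y∈L , det≢0 , coordinates) , Bxy≡0)
      where
      open ≡-Reasoning
      coordinates : ∀ z → InSpan L z → ∃₂ λ U V → z ≡ (U ·F x) +F (V ·F y)
      coordinates z z∈L with sound (αL⊆J z z∈L)
      ... | U , V , αz≡ = U , V , *F-cancelˡ α≢0 (begin
        α *F z                              ≡⟨ αz≡ ⟩
        pt (+ k ℤ.* + m ℤ.* U) (+ k ℤ.* V)  ≡⟨ latticeBasis-lincomb (+ k) (+ m) U V ⟨
        (U ·F e₁) +F (V ·F e₂)              ≡⟨ cong₂ (λ s t → (U ·F s) +F (V ·F t)) e₁≡αx e₂≡αy ⟩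
        (U ·F (α *F x)) +F (V ·F (α *F y))  ≡⟨ *F-lincomb α U V x y ⟨
        α *F ((U ·F x) +F (V ·F y))         ∎)
      det≢0 : detF x y ≢ 0ℚ
      det≢0 det≡0 = k*k*m≢0 (ℤ→ℚ-injective (begin
        ℤ→ℚ (+ k ℤ.* + k ℤ.* + m)  ≡⟨ detF-latticeBasis (+ k) (+ m) ⟨
        detF e₁ e₂                 ≡⟨ cong₂ detF e₁≡αx e₂≡αy ⟩
        detF (α *F x) (α *F y)     ≡⟨ detF-*F α x y ⟩
        N α * detF x y             ≡⟨ cong (N α *_) det≡0 ⟩
        N α * 0ℚ                   ≡⟨ ℚ.*-zeroʳ (N α) ⟩
        0ℚ                         ∎))
      Bxy≡0 : B x y ≡ 0ℚ
      Bxy≡0 = p≢0∧p*q≡0⇒q≡0 (N≢0 α≢0) (begin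
        N α * B x y          ≡⟨ B-*F α x y ⟨
        B (α *F x) (α *F y)  ≡⟨ cong₂ B e₁≡αx e₂≡αy ⟨
        B e₁ e₂              ≡⟨ B-latticeBasis (+ k) (+ m) ⟩
        0ℚ                   ∎)

  d≡a*b : ∀ {x y a b} → y ≢ 0F → √d *F y ≡ a ·F x → √d *F x ≡ b ·F y → -[1+ n ] ≡ a ℤ.* b
  d≡a*b {x} {y} {a} {b} y≢0 √dy≡ax √dx≡by = proj₁ (pt-injective { -[1+ n ]} {+ 0} {a ℤ.* b} {+ 0} (*F-cancelʳ y≢0 (begin
    pt -[1+ n ] (+ 0) *F y      ≡⟨ cong (_*F y) √d*√d ⟨
    (√d *F √d) *F y             ≡⟨ *F-assoc √d √d y ⟩
    √d *F (√d *F y)             ≡⟨ cong (√d *F_) √dy≡ax ⟩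
    √d *F (a ·F x)              ≡⟨ *F-·F a √d x ⟩
    a ·F (√d *F x)              ≡⟨ cong (a ·F_) √dx≡by ⟩
    a ·F (b ·F y)               ≡⟨ ·F-assoc a b y ⟨
    (a ℤ.* b) ·F y              ≡⟨ pt-*F (a ℤ.* b) y ⟨
    pt (a ℤ.* b) (+ 0) *F y     ∎)))
    where open ≡-Reasoning

  rescale-basis : ∀ {x y a} → y ≢ 0F → √d *F y ≡ a ·F x → ∃ λ α → α *F x ≡ √d × α *F y ≡ pt a (+ 0)
  rescale-basis {x} {y} {a} y≢0 √dy≡ax = pt a (+ 0) *F y⁻¹ , αx≡√d , αy≡a
    where
    open ≡-Reasoning
    y⁻¹ = proj₁ (*F-inverseˡ y≢0)
    y⁻¹y≡1 = proj₂ (*F-inverseˡ y≢0)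
    αx≡√d : (pt a (+ 0) *F y⁻¹) *F x ≡ √d
    αx≡√d = begin
      (pt a (+ 0) *F y⁻¹) *F x    ≡⟨ cong (_*F x) (*F-comm (pt a (+ 0)) y⁻¹) ⟩
      (y⁻¹ *F pt a (+ 0)) *F x    ≡⟨ *F-assoc y⁻¹ (pt a (+ 0)) x ⟩
      y⁻¹ *F (pt a (+ 0) *F x)    ≡⟨ cong (y⁻¹ *F_) (trans (pt-*F a x) (sym √dy≡ax)) ⟩
      y⁻¹ *F (√d *F y)            ≡⟨ cong (y⁻¹ *F_) (*F-comm √d y) ⟩
      y⁻¹ *F (y *F √d)            ≡⟨ *F-assoc y⁻¹ y √d ⟨
      (y⁻¹ *F y) *F √d            ≡⟨ cong (_*F √d) y⁻¹y≡1 ⟩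
      1F *F √d                    ≡⟨ *F-identityˡ √d ⟩
      √d                          ∎
    αy≡a : (pt a (+ 0) *F y⁻¹) *F y ≡ pt a (+ 0)
    αy≡a = begin
      (pt a (+ 0) *F y⁻¹) *F y    ≡⟨ *F-assoc (pt a (+ 0)) y⁻¹ y ⟩
      pt a (+ 0) *F (y⁻¹ *F y)    ≡⟨ cong (pt a (+ 0) *F_) y⁻¹y≡1 ⟩
      pt a (+ 0) *F 1F            ≡⟨ *F-identityʳ (pt a (+ 0)) ⟩
      pt a (+ 0)                  ∎

  rescaled-lincomb : ∀ {α x y a} → α *F x ≡ √d → α *F y ≡ pt a (+ 0) →
                      ∀ u v → α *F ((u ·F x) +F (v ·F y)) ≡ pt (v ℤ.* a) u
  rescaled-lincomb {α} {x} {y} {a} αx≡√d αy≡a u v = begin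
    α *F ((u ·F x) +F (v ·F y))           ≡⟨ *F-lincomb α u v x y ⟩
    (u ·F (α *F x)) +F (v ·F (α *F y))    ≡⟨ cong₂ (λ s t → (u ·F s) +F (v ·F t)) αx≡√d αy≡a ⟩
    (u ·F pt (+ 0) (+ 1)) +F (v ·F pt a (+ 0))
                                          ≡⟨ pt-lincomb u v (+ 0) (+ 1) a (+ 0) ⟩
    pt (u ℤ.* + 0 ℤ.+ v ℤ.* a) (u ℤ.* + 1 ℤ.+ v ℤ.* + 0)
                                          ≡⟨ cong₂ pt (re-identity u v a) (im-identity u v) ⟩
    pt (v ℤ.* a) u                        ∎
    where
    open ≡-Reasoning
    re-identity : ∀ u v a → u ℤ.* + 0 ℤ.+ v ℤ.* a ≡ v ℤ.* a
    re-identity = solve-∀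
    im-identity : ∀ u v → u ℤ.* + 1 ℤ.+ v ℤ.* + 0 ≡ u
    im-identity = solve-∀

  sameClass-of-rescaling : ∀ {L J x y α a} → ZBasis L x y → a ≢ + 0 → α *F x ≡ √d → α *F y ≡ pt a (+ 0) →
                           SpansLattice J (+ 1) (+ ∣ a ∣) → SameClass L J
  sameClass-of-rescaling {L} {J} {x} {y} {α} {a} (x∈L , y∈L , _ , coordinates) a≢0 αx≡√d αy≡a J-spans =
    α , α≢0 , J⊆αL , αL⊆J
    where
    open SpansLattice J-spans
    α≢0 : α ≢ 0F
    α≢0 refl = a≢0 (proj₁ (pt-injective {a} {+ 0} {+ 0} {+ 0} (trans (sym αy≡a) (trans (*F-comm 0F y) (*F-zeroʳ y)))))
    J⊆αL : ∀ z → InSpan J z → ∃ λ w → InSpan L w × z ≡ α *F w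
    J⊆αL z z∈J with sound z∈J | ∣i∣ℤ⊆iℤ a
    ... | U , V , refl | sign = (V ·F x) +F (U′ ·F y) , InSpan-lincomb V U′ x∈L y∈L ,
      sym (trans (rescaled-lincomb {α} {x} {y} {a} αx≡√d αy≡a V U′)
                 (cong₂ pt (trans U′a≡∣a∣U (cong (ℤ._* U) (sym (ℤ.*-identityˡ (+ ∣ a ∣))))) (sym (ℤ.*-identityˡ V))))
      where
      U′ = proj₁ (sign U)
      U′a≡∣a∣U = proj₂ (sign U)
    αL⊆J : ∀ w → InSpan L w → InSpan J (α *F w)
    αL⊆J w w∈L with coordinates w w∈L
    ... | u , v , refl = subst (InSpan J)
      (sym (trans (rescaled-lincomb {α} {x} {y} {a} αx≡√d αy≡a u v)
                  (cong₂ pt (trans (sym ∣a∣k≡va) (cong (ℤ._* k) (sym (ℤ.*-identityˡ (+ ∣ a ∣)))))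
                            (sym (ℤ.*-identityˡ u)))))
      (complete k u)
      where
      k = proj₁ (iℤ⊆∣i∣ℤ a v)
      ∣a∣k≡va = proj₂ (iℤ⊆∣i∣ℤ a v)

  orthogonal⇒ramifiedClass : (I : FracIdeal) → Orthogonal (gens I) → ProdOfRamifiedClasses (gens I)
  orthogonal⇒ramifiedClass I orthogonal = from-basis (orthogonal⇒orthogonalBasis orthogonal)
    where
    √d-closed : ∀ {z} → InSpan (gens I) z → InSpan (gens I) (√d *F z)
    √d-closed {z} z∈I = subst (λ t → InSpan (gens I) (t *F z)) ω≡√d (ωclosed I z z∈I)
    from-basis : ∃₂ (OrthogonalBasis (gens I)) → ProdOfRamifiedClasses (gens I)
    from-basis (x , y , ob@(basis@(x∈I , y∈I , _) , _)) =
      from-relations (orthogonalBasis-⊥y ob (√d-closed y∈I) (B-√d y)) (orthogonalBasis-⊥x ob (√d-closed x∈I) (B-√d x))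
      where
      from-relations : (∃ λ a → √d *F y ≡ a ·F x) → (∃ λ b → √d *F x ≡ b ·F y) → ProdOfRamifiedClasses (gens I)
      from-relations (a , √dy≡ax) (b , √dx≡by) =
        let rs , rs-ok , J-spans = ramifiedLattice-of-divisor {∣ a ∣} ∣a∣≢0 ∣a∣∣D
            α , αx≡√d , αy≡a = rescale-basis {x} {y} {a} (basis-y≢0 basis) √dy≡ax
        in rs , rs-ok , sameClass-of-rescaling {x = x} {y} {α} {a} basis a≢0 αx≡√d αy≡a J-spans
        where
        d≡ab : -[1+ n ] ≡ a ℤ.* b
        d≡ab = d≡a*b {x} {y} {a} {b} (basis-y≢0 basis) √dy≡ax √dx≡by
        a≢0 : a ≢ + 0
        a≢0 a≡0 = case trans d≡ab (trans (cong (ℤ._* b) a≡0) (ℤ.*-zeroˡ b)) of λ ()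
        ∣a∣≢0 : ∣ a ∣ ≢ 0
        ∣a∣≢0 ∣a∣≡0 = a≢0 (ℤ.∣i∣≡0⇒i≡0 ∣a∣≡0)
        ∣a∣∣D : ∣ a ∣ ∣ suc n
        ∣a∣∣D = divides ∣ b ∣ (trans (cong ∣_∣ d≡ab) (trans (ℤ.abs-* a b) (ℕ.*-comm ∣ a ∣ ∣ b ∣)))

ω≡½[1+√d] : ∀ d → d %ℕ 4 ≡ 1 → Field.ω d ≡ ⟨ ½ , ½ ⟩
ω≡½[1+√d] d d%4≡1 = cong (λ b → if b then ⟨ ½ , ½ ⟩ else ⟨ 0ℚ , 1ℚ ⟩) (dec-true (d %ℕ 4 ℕ.≟ 1) d%4≡1)

ω≡√d : ∀ d → Cong23mod4 d → Field.ω d ≡ Field.√d d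
ω≡√d d d%4≡2∨3 = cong (λ b → if b then ⟨ ½ , ½ ⟩ else ⟨ 0ℚ , 1ℚ ⟩) (dec-false (d %ℕ 4 ℕ.≟ 1) (d%4≢1 d%4≡2∨3))
  where
  d%4≢1 : Cong23mod4 d → d %ℕ 4 ≢ 1
  d%4≢1 (inj₁ d%4≡2) d%4≡1 = case trans (sym d%4≡2) d%4≡1 of λ ()
  d%4≢1 (inj₂ d%4≡3) d%4≡1 = case trans (sym d%4≡3) d%4≡1 of λ ()

residues-mod-4 : ∀ d → d %ℕ 4 ≡ 0 ⊎ d %ℕ 4 ≡ 1 ⊎ Cong23mod4 d
residues-mod-4 d = classify (d %ℕ 4) (n%ℕd<d d 4) refl
  where
  classify : ∀ r → r ℕ.< 4 → d %ℕ 4 ≡ r → d %ℕ 4 ≡ 0 ⊎ d %ℕ 4 ≡ 1 ⊎ Cong23mod4 d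
  classify 0 _ d%4≡r = inj₁ d%4≡r
  classify 1 _ d%4≡r = inj₂ (inj₁ d%4≡r)
  classify 2 _ d%4≡r = inj₂ (inj₂ (inj₁ d%4≡r))
  classify 3 _ d%4≡r = inj₂ (inj₂ (inj₂ d%4≡r))
  classify (suc (suc (suc (suc _)))) (s≤s (s≤s (s≤s (s≤s ())))) _

squarefree⇒d%4≢0 : ∀ {d} → SquareFree d → d %ℕ 4 ≢ 0
squarefree⇒d%4≢0 {d} squarefree d%4≡0 = case squarefree 2 (divides ∣ d /ℕ 4 ∣ ∣d∣≡∣d/4∣*4) of λ ()
  where
  ∣d∣≡∣d/4∣*4 : ∣ d ∣ ≡ ∣ d /ℕ 4 ∣ ℕ.* 4
  ∣d∣≡∣d/4∣*4 = trans (cong ∣_∣ (trans (a≡a%ℕn+[a/ℕn]*n d 4)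
                  (trans (cong (λ r → + r ℤ.+ (d /ℕ 4) ℤ.* + 4) d%4≡0) (ℤ.+-identityˡ ((d /ℕ 4) ℤ.* + 4)))))
                  (ℤ.abs-* (d /ℕ 4) (+ 4))

orthogonal⇒d%4≡2∨3 : ∀ n → SquareFree -[1+ n ] → (I : Field.FracIdeal -[1+ n ]) →
                      Field.Orthogonal -[1+ n ] (Field.FracIdeal.gens I) → Cong23mod4 -[1+ n ]
orthogonal⇒d%4≡2∨3 n squarefree I orthogonal = from-residue (residues-mod-4 -[1+ n ])
  where
  from-residue : _ ⊎ _ ⊎ Cong23mod4 -[1+ n ] → Cong23mod4 -[1+ n ]
  from-residue (inj₁ d%4≡0)        = ⊥-elim (squarefree⇒d%4≢0 { -[1+ n ]} squarefree d%4≡0)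
  from-residue (inj₂ (inj₁ d%4≡1)) = ⊥-elim (Imaginary.¬orthogonal-if-ω≡½[1+√d] n (ω≡½[1+√d] -[1+ n ] d%4≡1) I orthogonal)
  from-residue (inj₂ (inj₂ d%4≡2∨3)) = d%4≡2∨3

proposition5p6 : (d : ℤ) → d < + 0 → SquareFree d →
  ((I : Field.FracIdeal d) → Field.Orthogonal d (Field.FracIdeal.gens I) → Cong23mod4 d)
  × (Cong23mod4 d → (I : Field.FracIdeal d) →
      Field.Orthogonal d (Field.FracIdeal.gens I) ⇔ Field.ProdOfRamifiedClasses d (Field.FracIdeal.gens I))
proposition5p6 (+ _)    (ℤ.+<+ ())
proposition5p6 -[1+ n ] _ squarefree =
  orthogonal⇒d%4≡2∨3 n squarefree ,
  λ d%4≡2∨3 I → let open Classification n squarefree (ω≡√d -[1+ n ] d%4≡2∨3) in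
    mk⇔ (orthogonal⇒ramifiedClass I) (ramifiedClass⇒orthogonal (Field.FracIdeal.gens I))
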